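{- Let $k>6$ and $n\ge 1$ be integers, and put $M=n+\frac23\sum_{\ell=3n+4}^{6n+1}e_{n,\ell}\,v_2(k-\ell)$. Then the Newton polygon $N(P_{\mathrm{BC}})$ has a vertex at $n$ if and only if the Newton polygon of the truncation $P_{\mathrm{BC}}^{\deg\le M}$ has a vertex at $n$; in this case $N(P_{\mathrm{BC}})^{\le n}=N\big(P_{\mathrm{BC}}^{\deg\le n}\big)$.
   Context: Let $S_{2k}$ be the space of cusp forms of weight $2k$ for $\mathrm{SL}_2(\mathbb{Z})$, $m=\dim S_{2k}$, and $$P_{\mathrm{BC}}(X)=1+\sum_{n=1}^m X^n\prod_{j=1}^n\frac{2^{2j}(2k-8j)!(2k-8j-3)!(2k-12j-2)}{(2k-12j)!(2k-6j-1)!}.$$ For an integer $\ell$ let $\delta_\ell=1$ if $\ell\equiv 1\pmod 6$ and $0$ otherwise, and for $3n+4\le\ell\le 6n+1$: $e_{n,\ell}=\lfloor(\ell-1)/3\rfloor-n$ if $3n+4\le\ell<4n$; $e_{n,\ell}=\delta_\ell+n-1-\lfloor\ell/6\rfloor$ if $\ell\in\{4n,4n+1\}$; $e_{n,\ell}=\delta_\ell+n-\lfloor\ell/6\rfloor$ if $4n+2\le\ell\le 6n$; $e_{n,\ell}=1$ if $\ell=6n+1$. $v_2$ is the $2$-adic valuation. For $P=\sum_ic_iX^i$, $N(P)$ is the lower convex hull of $\{(i,v_2(c_i)):c_i\ne0\}$; a vertex at $n$ means a break point with $x$-coordinate $n$; $P^{\deg\le M}=\sum_{i\le M}c_iX^i$;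 $N^{\le n}$ is the part of $N$ in $0\le x\le n$. -}

module Defs where

open import Data.Bool using (Bool; true; false; if_then_else_; _∧_; _∨_; not)
open import Data.Nat as ℕ using (ℕ; zero; suc; _∸_; _!; ∣_-_∣; _≡ᵇ_; _≤ᵇ_; _<ᵇ_; _%_)
open import Data.Nat.Properties using (_!*_!≢0)
import Data.Nat.DivMod as NDM
open import Data.Integer as ℤ using (ℤ; +_)
open import Data.Rational as ℚ using (ℚ; ↥_; ↧ₙ_; 0ℚ; 1ℚ)
open import Data.List using (List; map; upTo; foldr)
open import Data.Bool.ListAction using (any)
open import Data.Product using (Σ; _×_; ∃)
open import Relation.Binary.PropositionalEquality using (_≡_; _≢_)

-- v2aux fuel n : number of times 2 divides n (fuel n is always enough,
-- since each step halves n).  Value at 0 is 0 (never used where it matters).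
v2aux : ℕ → ℕ → ℕ
v2aux zero    n       = 0
v2aux (suc f) zero    = 0
v2aux (suc f) (suc n) =
  if (suc n % 2) ≡ᵇ 0 then suc (v2aux f (NDM._/_ (suc n) 2)) else 0

v2ℕ : ℕ → ℕ
v2ℕ n = v2aux n n

v2ℚ : ℚ → ℤ
v2ℚ q = (+ v2ℕ ℤ.∣ ↥ q ∣) ℤ.- (+ v2ℕ (↧ₙ q))

-- m = dim S_{2k} for SL_2(Z)  (valid for 2k ≥ 4):
-- floor(2k/12) - 1 if 2k ≡ 2 mod 12, floor(2k/12) otherwise.
dimS : ℕ → ℕ
dimS k = if (k % 6) ≡ᵇ 1 then NDM._/_ k 6 ∸ 1 else NDM._/_ k 6

-- the j-th factor of the product defining the coefficients of P_BC
--   2^{2j} (2k-8j)! (2k-8j-3)! (2k-12j-2) / ((2k-12j)! (2k-6j-1)!)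
-- (for 1 ≤ j ≤ dim S_{2k} and k > 6 all factorial arguments are ≥ 0,
--  so truncated subtraction ∸ is exact there)
factorBC : ℕ → ℕ → ℚ
factorBC k j =
  ℚ._/_ ((+ (2 ℕ.^ (2 ℕ.* j) ℕ.* (2 ℕ.* k ∸ 8 ℕ.* j) ! ℕ.* (2 ℕ.* k ∸ 8 ℕ.* j ∸ 3) !))
          ℤ.* ((+ (2 ℕ.* k)) ℤ.- (+ (12 ℕ.* j)) ℤ.- (+ 2)))
        ((2 ℕ.* k ∸ 12 ℕ.* j) ! ℕ.* (2 ℕ.* k ∸ 6 ℕ.* j ∸ 1) !)
        {{(2 ℕ.* k ∸ 12 ℕ.* j) !* (2 ℕ.* k ∸ 6 ℕ.* j ∸ 1) !≢0}}

prodBC : ℕ → ℕ → ℚ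
prodBC k zero    = 1ℚ
prodBC k (suc n) = prodBC k n ℚ.* factorBC k (suc n)

-- coefficient of X^i in P_BC (weight 2k); degree ≤ m = dimS k
PBC : ℕ → ℕ → ℚ
PBC k i = if i ≤ᵇ dimS k then prodBC k i else 0ℚ

-- Polynomials with rational coefficients are coefficient functions
-- ℕ → ℚ (finitely supported).  Truncation by a Boolean degree filter.
trunc : (ℕ → ℚ) → (ℕ → Bool) → ℕ → ℚ
trunc c keep i = if keep i then c i else 0ℚ

ι : ℕ → ℚ
ι n = ℚ._/_ (+ n) 1

-- Newton polygon N(c) = lower convex hull of {(i, v2(c_i)) : c_i ≠ 0}.
-- Vertex (break point) at x-coordinate n: (n, v2(c_n)) is a point of the set
-- and lies strictly below every chord joining points to its left and right.
-- (Endpoints of the polygon are vertices.)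
IsVertex : (ℕ → ℚ) → ℕ → Set
IsVertex c n =
  c n ≢ 0ℚ ×
  (∀ i j → i ℕ.< n → n ℕ.< j → c i ≢ 0ℚ → c j ≢ 0ℚ →
     (+ (j ∸ i)) ℤ.* v2ℚ (c n)
       ℤ.< (+ (j ∸ n)) ℤ.* v2ℚ (c i) ℤ.+ (+ (n ∸ i)) ℤ.* v2ℚ (c j))

-- (x , y) lies on or above the Newton polygon N(c) (the epigraph of the lower
-- convex hull; by Carathéodory in dimension 1 it is enough to use convex
-- combinations of two points of the set).
Epi : (ℕ → ℚ) → ℚ → ℚ → Set
Epi c x y =
  Σ ℕ λ i → Σ ℕ λ j → Σ ℚ λ t →
    c i ≢ 0ℚ × c j ≢ 0ℚ × 0ℚ ℚ.≤ t × t ℚ.≤ 1ℚ ×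
    x ≡ (1ℚ ℚ.- t) ℚ.* ι i ℚ.+ t ℚ.* ι j ×
    (1ℚ ℚ.- t) ℚ.* (ℚ._/_ (v2ℚ (c i)) 1) ℚ.+ t ℚ.* (ℚ._/_ (v2ℚ (c j)) 1) ℚ.≤ y

-- N(c)^{≤n} = N(d)^{≤n}: the two polygons coincide over 0 ≤ x ≤ n
-- (equivalently their epigraphs over that strip coincide).
SamePolygonUpTo : ℕ → (ℕ → ℚ) → (ℕ → ℚ) → Set
SamePolygonUpTo n c d =
  ∀ x y → 0ℚ ℚ.≤ x → x ℚ.≤ ι n → (Epi c x y → Epi d x y) × (Epi d x y → Epi c x y)

δ : ℕ → ℤ
δ ℓ = if (ℓ % 6) ≡ᵇ 1 then + 1 else + 0

-- e_{n,ℓ}, meaningful for 3n+4 ≤ ℓ ≤ 6n+1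
e : ℕ → ℕ → ℤ
e n ℓ =
  if ℓ <ᵇ 4 ℕ.* n then (+ NDM._/_ (ℓ ∸ 1) 3) ℤ.- (+ n)
  else if ℓ ≤ᵇ 4 ℕ.* n ℕ.+ 1 then δ ℓ ℤ.+ (+ n) ℤ.- (+ 1) ℤ.- (+ NDM._/_ ℓ 6)
  else if ℓ ≤ᵇ 6 ℕ.* n then δ ℓ ℤ.+ (+ n) ℤ.- (+ NDM._/_ ℓ 6)
  else + 1

ℓRange : ℕ → List ℕ
ℓRange n = map (λ d → 3 ℕ.* n ℕ.+ 4 ℕ.+ d) (upTo ((6 ℕ.* n ℕ.+ 2) ∸ (3 ℕ.* n ℕ.+ 4)))

-- S = Σ_ℓ e_{n,ℓ} v2(k-ℓ), with the convention 0·∞ = 0 for terms with ℓ = k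
sumE : ℕ → ℕ → ℤ
sumE k n = foldr ℤ._+_ (+ 0)
  (map (λ ℓ → if ℓ ≡ᵇ k then + 0 else e n ℓ ℤ.* (+ v2ℕ ∣ k - ℓ ∣)) (ℓRange n))

isZeroℤ : ℤ → Bool
isZeroℤ (+ 0) = true
isZeroℤ _     = false

-- M = ∞ iff some ℓ = k with e_{n,ℓ} ≠ 0 (v2(0) = ∞)
Minfinite : ℕ → ℕ → Bool
Minfinite k n = any (λ ℓ → (ℓ ≡ᵇ k) ∧ not (isZeroℤ (e n ℓ))) (ℓRange n)

-- i ≤ M = n + (2/3) S   ⇔   3i ≤ 3n + 2S
≤M : ℕ → ℕ → ℕ → Bool
≤M k n i = Minfinite k n ∨ ((+ (3 ℕ.* i)) ℤ.≤ᵇ (+ (3 ℕ.* n)) ℤ.+ (+ 2) ℤ.* sumE k n)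

module Submission where

-- The core is an exact formula for the valuations of the coefficients c_i:
--   v₂(c_i) = 3i(i+1)/2 + E_i,   E_i = Σ_ℓ p(i, ℓ)·v₂|k − ℓ|   (i ≤ m).
-- It comes from v₂ of factorials (one halving step of Legendre's formula and a
-- telescoping sum of v₂|k − ℓ| over windows of ℓ), the multiplicities p(i, ℓ)
-- being counts of t ≤ i in explicit intervals.  Evaluating these counts via
-- floor identities (checked over one period of 12) gives p ≥ 0, p = 0 outside
-- 3i + 4 ≤ ℓ ≤ 6i + 1 and p = e_{i,ℓ} inside; hence E_i ≥ 0 and E_n = S.
-- As 3i(i+1)/2 is strictly convex, every degree j > M already satisfies the
-- chord inequality at n, so dropping those degrees does not affect the vertex
-- condition (vertex-truncation).  The second claim is plane geometry: a chord
-- crossing x = n can be shortened at the vertex (vertex-cuts-polygon).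

open import Defs
open import Data.Bool using (Bool; true; false; T; _∨_; if_then_else_)
open import Data.Empty using (⊥; ⊥-elim)
open import Data.Integer as ℤ using (ℤ; +_; -[1+_])
import Data.Integer.GCD as ℤGCD
import Data.Integer.Properties as ℤₚ
import Data.Integer.Tactic.RingSolver as ℤSolver
open import Data.List using (foldr; map; upTo; applyUpTo)
import Data.List.Properties as Listₚ
open import Data.Nat as ℕ using (ℕ; zero; suc; _+_; _*_; _∸_; _^_; _≤_; _<_; _≤ᵇ_; _!; ∣_-_∣; _⊓_; pred; NonZero; z≤n; s≤s)
open import Data.Nat.DivMod using (_/_; _%_)
import Data.Nat.DivMod as ℕ÷
import Data.Nat.Divisibility as ℕ∣
import Data.Nat.Coprimality as ℕCoprime
import Data.Nat.Properties as ℕₚ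
open import Data.Nat.Tactic.RingSolver using (solve-∀)
open import Data.Product using (Σ; _×_; _,_; proj₁; proj₂)
open import Data.Rational as ℚ using (ℚ; mkℚ; 0ℚ; 1ℚ)
import Data.Rational.Properties as ℚₚ
open import Data.Sum using (_⊎_; inj₁; inj₂)
open import Data.Unit using (tt)
open import Function.Base using (_∘′_)
open import Function.Bundles using (_⇔_; mk⇔)
open import Relation.Binary.PropositionalEquality
open import Relation.Nullary using (¬_; Dec; yes; no)
open import Relation.Nullary.Decidable using (_×-dec_)
import Data.Rational.Solver as ℚSolver

v2aux-fuel : ∀ f g n → n ≤ f → n ≤ g → v2aux f n ≡ v2aux g n
v2aux-fuel zero    zero    zero    _         _         = refl
v2aux-fuel zero    (suc g) zero    _         _         = refl
v2aux-fuel (suc f) zero    zero    _         _         = refl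
v2aux-fuel (suc f) (suc g) zero    _         _         = refl
v2aux-fuel (suc f) (suc g) (suc n) (s≤s n≤f) (s≤s n≤g) with suc n % 2 ℕ.≡ᵇ 0
... | false = refl
... | true  = cong suc (v2aux-fuel f g (suc n / 2) (ℕₚ.≤-trans half≤n n≤f) (ℕₚ.≤-trans half≤n n≤g))
  where
  half≤n : suc n / 2 ≤ n
  half≤n = ℕₚ.<⇒≤pred (ℕ÷.m/n<m (suc n) 2 (s≤s (s≤s z≤n)))

parity : ∀ n → Σ ℕ λ q → (n ≡ 2 * q) ⊎ (n ≡ suc (2 * q))
parity zero = 0 , inj₁ refl
parity (suc n) with parity n
... | q , inj₁ refl = q , inj₂ refl
... | q , inj₂ refl = suc q , inj₁ (cong suc (sym (ℕₚ.+-suc q (q + 0))))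

v2-odd : ∀ q → v2ℕ (suc (2 * q)) ≡ 0
v2-odd q with suc (2 * q) % 2 ℕ.≡ᵇ 0 in eq
... | false = refl
... | true  = ⊥-elim (true≢false (trans (sym eq) (cong (ℕ._≡ᵇ 0) odd%2)))
  where
  odd%2 : suc (2 * q) % 2 ≡ 1
  odd%2 = trans (cong (λ z → suc z % 2) (ℕₚ.*-comm 2 q)) (ℕ÷.[m+kn]%n≡m%n 1 q 2)
  true≢false : true ≢ false
  true≢false ()

v2-even : ∀ q → 0 < q → v2ℕ (2 * q) ≡ suc (v2ℕ q)
v2-even (suc q) _ with 2 * suc q % 2 ℕ.≡ᵇ 0 in eq
... | true  = cong suc (trans (cong (v2aux (q + suc (q + 0))) half) (v2aux-fuel _ (suc q) (suc q) enough ℕₚ.≤-refl))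
  where
  half : 2 * suc q / 2 ≡ suc q
  half = trans (cong (_/ 2) (ℕₚ.*-comm 2 (suc q))) (ℕ÷.m*n/n≡m (suc q) 2)
  enough : suc q ≤ q + suc (q + 0)
  enough = ℕₚ.≤-trans (s≤s (ℕₚ.m≤m+n q (q + 0))) (ℕₚ.≤-reflexive (sym (ℕₚ.+-suc q (q + 0))))
... | false = ⊥-elim (true≢false (trans (sym (cong (ℕ._≡ᵇ 0) even%2)) eq))
  where
  even%2 : 2 * suc q % 2 ≡ 0
  even%2 = trans (cong (_% 2) (ℕₚ.*-comm 2 (suc q))) (ℕ÷.m*n%n≡0 (suc q) 2)
  true≢false : true ≢ false
  true≢false ()

-- v₂ is additive on positive integers.  The proof peels a factor 2 off an
-- even factor (or stops when both are odd); m + n bounds the recursion depth.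
v2-mul : ∀ m n → 0 < m → 0 < n → v2ℕ (m * n) ≡ v2ℕ m + v2ℕ n
v2-mul m n = go (m + n) m n ℕₚ.≤-refl
  where
  pos-half : ∀ a → 0 < 2 * a → 0 < a
  pos-half (suc a) _ = s≤s z≤n
  pos-* : ∀ {a b} → 0 < a → 0 < b → 0 < a * b
  pos-* {suc a} {suc b} _ _ = s≤s z≤n
  smaller : ∀ a → 0 < a → a < 2 * a
  smaller (suc a) _ = ℕₚ.m<m+n (suc a) (s≤s (z≤n {a + 0}))
  step : ∀ {x y f} → x < y → y ≤ suc f → x ≤ f
  step x<y y≤ = ℕₚ.≤-pred (ℕₚ.≤-trans x<y y≤)
  go : ∀ f m n → m + n ≤ f → 0 < m → 0 < n → v2ℕ (m * n) ≡ v2ℕ m + v2ℕ n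
  go zero    (suc m) n () _ _
  go (suc f) m n bound pm pn with parity m
  ... | a , inj₁ refl = begin
      v2ℕ (2 * a * n)         ≡⟨ cong v2ℕ (ℕₚ.*-assoc 2 a n) ⟩
      v2ℕ (2 * (a * n))       ≡⟨ v2-even (a * n) (pos-* pa pn) ⟩
      suc (v2ℕ (a * n))       ≡⟨ cong suc (go f a n (step (ℕₚ.+-monoˡ-< n (smaller a pa)) bound) pa pn) ⟩
      suc (v2ℕ a + v2ℕ n)     ≡⟨ cong (_+ v2ℕ n) (sym (v2-even a pa)) ⟩
      v2ℕ (2 * a) + v2ℕ n     ∎
    where
    open ≡-Reasoning
    pa = pos-half a pm
  ... | a , inj₂ refl with parity n
  ...   | b , inj₂ refl = begin
      v2ℕ (suc (2 * a) * suc (2 * b))           ≡⟨ cong v2ℕ (odd*odd a b) ⟩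
      v2ℕ (suc (2 * (a + b + 2 * (a * b))))     ≡⟨ v2-odd (a + b + 2 * (a * b)) ⟩
      0                                         ≡⟨ sym (cong₂ _+_ (v2-odd a) (v2-odd b)) ⟩
      v2ℕ (suc (2 * a)) + v2ℕ (suc (2 * b))     ∎
    where
    open ≡-Reasoning
    odd*odd : ∀ a b → suc (2 * a) * suc (2 * b) ≡ suc (2 * (a + b + 2 * (a * b)))
    odd*odd = solve-∀
  ...   | b , inj₁ refl = begin
      v2ℕ (m * (2 * b))         ≡⟨ cong v2ℕ (swap m b) ⟩
      v2ℕ (2 * (m * b))         ≡⟨ v2-even (m * b) (pos-* pm pb) ⟩
      suc (v2ℕ (m * b))         ≡⟨ cong suc (go f m b (step (ℕₚ.+-monoʳ-< m (smaller b pb)) bound) pm pb) ⟩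
      suc (v2ℕ m + v2ℕ b)       ≡⟨ sym (ℕₚ.+-suc (v2ℕ m) (v2ℕ b)) ⟩
      v2ℕ m + suc (v2ℕ b)       ≡⟨ cong (λ z → v2ℕ m + z) (sym (v2-even b pb)) ⟩
      v2ℕ m + v2ℕ (2 * b)       ∎
    where
    open ≡-Reasoning
    pb = pos-half b pn
    swap : ∀ m b → m * (2 * b) ≡ 2 * (m * b)
    swap = solve-∀

v2-pow : ∀ e z → 0 < z → v2ℕ (2 ^ e * z) ≡ e + v2ℕ z
v2-pow zero    z _  = cong v2ℕ (ℕₚ.+-identityʳ z)
v2-pow (suc e) z pz = begin
  v2ℕ (2 * 2 ^ e * z)   ≡⟨ cong v2ℕ (ℕₚ.*-assoc 2 (2 ^ e) z) ⟩
  v2ℕ (2 * (2 ^ e * z)) ≡⟨ v2-even (2 ^ e * z) (ℕₚ.*-mono-< {0} {2 ^ e} {0} (ℕₚ.m^n>0 2 e) pz) ⟩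
  suc (v2ℕ (2 ^ e * z)) ≡⟨ cong suc (v2-pow e z pz) ⟩
  suc (e + v2ℕ z)       ∎
  where open ≡-Reasoning

factors-pos : ∀ x y → 0 < x * y → (0 < x) × (0 < y)
factors-pos (suc x) (suc y) _ = s≤s z≤n , s≤s z≤n
factors-pos zero    y       ()
factors-pos (suc x) zero    p = ⊥-elim (ℕₚ.<-irrefl (sym (ℕₚ.*-zeroʳ (suc x))) p)

∣i∣-pos : ∀ i → i ≢ + 0 → 0 < ℤ.∣ i ∣
∣i∣-pos i i≢0 = ℕₚ.n≢0⇒n>0 (λ e → i≢0 (ℤₚ.∣i∣≡0⇒i≡0 e))

*-nonzero : ∀ a b → a ≢ + 0 → b ≢ + 0 → a ℤ.* b ≢ + 0
*-nonzero a b a≢0 b≢0 e with ℤₚ.i*j≡0⇒i≡0∨j≡0 a e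
... | inj₁ a≡0 = a≢0 a≡0
... | inj₂ b≡0 = b≢0 b≡0

+-cancel-diff : ∀ a b c → + (a + c) ℤ.- + (b + c) ≡ + a ℤ.- + b
+-cancel-diff a b c = begin
  + (a + c) ℤ.- + (b + c)           ≡⟨ cong₂ ℤ._-_ (ℤₚ.pos-+ a c) (ℤₚ.pos-+ b c) ⟩
  (+ a ℤ.+ + c) ℤ.- (+ b ℤ.+ + c)   ≡⟨ cancel (+ a) (+ b) (+ c) ⟩
  + a ℤ.- + b                       ∎
  where
  open ≡-Reasoning
  cancel : ∀ x y z → (x ℤ.+ z) ℤ.- (y ℤ.+ z) ≡ x ℤ.- y
  cancel = ℤSolver.solve-∀

/-nonzero : ∀ (i : ℤ) (n : ℕ) .{{_ : NonZero n}} → i ≢ + 0 → i ℚ./ n ≢ 0ℚ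
/-nonzero i n i≢0 eq = i≢0 (trans (sym (ℚₚ.↥-/ i n)) (cong (ℤ._* ℤGCD.gcd i (+ n)) (ℚₚ.p≡0⇒↥p≡0 _ eq)))

-- v₂(i / n) = v₂(i) − v₂(n), whatever common factor the normalisation removes:
-- the cancelled gcd contributes equally to numerator and denominator.
v2ℚ-/ : ∀ (i : ℤ) (n : ℕ) .{{_ : NonZero n}} → i ≢ + 0 →
        v2ℚ (i ℚ./ n) ≡ + v2ℕ ℤ.∣ i ∣ ℤ.- + v2ℕ n
v2ℚ-/ i n i≢0 = begin
  + v2ℕ ∣p∣ ℤ.- + v2ℕ q                                    ≡⟨ sym (+-cancel-diff (v2ℕ ∣p∣) (v2ℕ q) (v2ℕ ∣g∣)) ⟩
  + (v2ℕ ∣p∣ + v2ℕ ∣g∣) ℤ.- + (v2ℕ q + v2ℕ ∣g∣)            ≡⟨ cong₂ (λ a b → + a ℤ.- + b) (sym (split ∣p∣ ∣i∣-eq (∣i∣-pos i i≢0))) (sym (split q n-eq (ℕ.>-nonZero⁻¹ n))) ⟩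
  + v2ℕ ℤ.∣ i ∣ ℤ.- + v2ℕ n                                ∎
  where
  open ≡-Reasoning
  r = i ℚ./ n
  ∣p∣ = ℤ.∣ ℚ.↥ r ∣
  q = ℚ.↧ₙ r
  ∣g∣ = ℤ.∣ ℤGCD.gcd i (+ n) ∣
  ∣i∣-eq : ∣p∣ * ∣g∣ ≡ ℤ.∣ i ∣
  ∣i∣-eq = trans (sym (ℤₚ.abs-* (ℚ.↥ r) (ℤGCD.gcd i (+ n)))) (cong ℤ.∣_∣ (ℚₚ.↥-/ i n))
  n-eq : q * ∣g∣ ≡ n
  n-eq = trans (sym (ℤₚ.abs-* (ℚ.↧ r) (ℤGCD.gcd i (+ n)))) (cong ℤ.∣_∣ (ℚₚ.↧-/ i n))
  split : ∀ a {N} → a * ∣g∣ ≡ N → 0 < N → v2ℕ N ≡ v2ℕ a + v2ℕ ∣g∣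
  split a refl N>0 = v2-mul a ∣g∣ (proj₁ (factors-pos a ∣g∣ N>0)) (proj₂ (factors-pos a ∣g∣ N>0))

↥-nonzero : ∀ p → p ≢ 0ℚ → ℚ.↥ p ≢ + 0
↥-nonzero p p≢0 e = p≢0 (ℚₚ.↥p≡0⇒p≡0 p e)

*-nonzeroℚ : ∀ p q → p ≢ 0ℚ → q ≢ 0ℚ → p ℚ.* q ≢ 0ℚ
*-nonzeroℚ p@(mkℚ a d _) q@(mkℚ a' d' _) p≢0 q≢0 =
  /-nonzero (a ℤ.* a') (suc d * suc d') (*-nonzero a a' (↥-nonzero p p≢0) (↥-nonzero q q≢0))

v2ℚ-* : ∀ p q → p ≢ 0ℚ → q ≢ 0ℚ → v2ℚ (p ℚ.* q) ≡ v2ℚ p ℤ.+ v2ℚ q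
v2ℚ-* p@(mkℚ a d _) q@(mkℚ a' d' _) p≢0 q≢0 = begin
  v2ℚ (p ℚ.* q)
    ≡⟨ v2ℚ-/ (a ℤ.* a') (suc d * suc d') (*-nonzero a a' a≢0 a'≢0) ⟩
  + v2ℕ ℤ.∣ a ℤ.* a' ∣ ℤ.- + v2ℕ (suc d * suc d')
    ≡⟨ cong₂ (λ x y → + x ℤ.- + y) num den ⟩
  + (v2ℕ ℤ.∣ a ∣ + v2ℕ ℤ.∣ a' ∣) ℤ.- + (v2ℕ (suc d) + v2ℕ (suc d'))
    ≡⟨ cong₂ ℤ._-_ (ℤₚ.pos-+ (v2ℕ ℤ.∣ a ∣) _) (ℤₚ.pos-+ (v2ℕ (suc d)) _) ⟩
  (+ v2ℕ ℤ.∣ a ∣ ℤ.+ + v2ℕ ℤ.∣ a' ∣) ℤ.- (+ v2ℕ (suc d) ℤ.+ + v2ℕ (suc d'))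
    ≡⟨ regroup (+ v2ℕ ℤ.∣ a ∣) (+ v2ℕ ℤ.∣ a' ∣) (+ v2ℕ (suc d)) (+ v2ℕ (suc d')) ⟩
  v2ℚ p ℤ.+ v2ℚ q
    ∎
  where
  open ≡-Reasoning
  a≢0 = ↥-nonzero p p≢0
  a'≢0 = ↥-nonzero q q≢0
  num : v2ℕ ℤ.∣ a ℤ.* a' ∣ ≡ v2ℕ ℤ.∣ a ∣ + v2ℕ ℤ.∣ a' ∣
  num = trans (cong v2ℕ (ℤₚ.abs-* a a')) (v2-mul _ _ (∣i∣-pos a a≢0) (∣i∣-pos a' a'≢0))
  den : v2ℕ (suc d * suc d') ≡ v2ℕ (suc d) + v2ℕ (suc d')
  den = v2-mul (suc d) (suc d') (s≤s z≤n) (s≤s z≤n)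
  regroup : ∀ x y z w → (x ℤ.+ y) ℤ.- (z ℤ.+ w) ≡ (x ℤ.- z) ℤ.+ (y ℤ.- w)
  regroup = ℤSolver.solve-∀

v2! : ℕ → ℕ
v2! n = v2ℕ (n !)

v2!-suc : ∀ n → v2! (suc n) ≡ v2ℕ (suc n) + v2! n
v2!-suc n = v2-mul (suc n) (n !) (s≤s z≤n) (ℕₚ.1≤n! n)

v2!-even : ∀ y → v2! (2 * y) ≡ y + v2! y
v2!-odd  : ∀ y → v2! (suc (2 * y)) ≡ y + v2! y
v2!-odd y = trans (v2!-suc (2 * y)) (trans (cong (_+ v2! (2 * y)) (v2-odd y)) (v2!-even y))
v2!-even zero    = refl
v2!-even (suc y) = begin
  v2! (2 * suc y)                                 ≡⟨ cong v2! (double-suc y) ⟩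
  v2! (suc (suc (2 * y)))                         ≡⟨ v2!-suc (suc (2 * y)) ⟩
  v2ℕ (suc (suc (2 * y))) + v2! (suc (2 * y))     ≡⟨ cong₂ _+_ (trans (cong v2ℕ (sym (double-suc y))) (v2-even (suc y) (s≤s z≤n))) (v2!-odd y) ⟩
  suc (v2ℕ (suc y)) + (y + v2! y)                 ≡⟨ shuffle (v2ℕ (suc y)) y (v2! y) ⟩
  suc y + (v2ℕ (suc y) + v2! y)                   ≡⟨ cong (λ z → suc y + z) (sym (v2!-suc y)) ⟩
  suc y + v2! (suc y)                             ∎
  where
  open ≡-Reasoning
  double-suc : ∀ y → 2 * suc y ≡ suc (suc (2 * y))
  double-suc = solve-∀
  shuffle : ∀ a b c → suc a + (b + c) ≡ suc b + (a + c)
  shuffle = solve-∀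

w : ℕ → ℕ → ℕ
w k ℓ = v2ℕ ∣ k - ℓ ∣

window : ℕ → ℕ → ℕ → ℕ
window k a zero      = 0
window k a (suc len) = w k a + window k (suc a) len

v2!-window : ∀ k len a → a + len ≤ k → v2! (k ∸ a) ≡ window k a len + v2! (k ∸ (a + len))
v2!-window k zero      a _     = cong (λ z → v2! (k ∸ z)) (sym (ℕₚ.+-identityʳ a))
v2!-window k (suc len) a bound = begin
  v2! (k ∸ a)                                          ≡⟨ cong v2! k∸a≡suc ⟩
  v2! (suc (k ∸ suc a))                                ≡⟨ v2!-suc (k ∸ suc a) ⟩
  v2ℕ (suc (k ∸ suc a)) + v2! (k ∸ suc a)              ≡⟨ cong₂ _+_ (cong v2ℕ (sym dist)) (v2!-window k len (suc a) bound′) ⟩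
  w k a + (window k (suc a) len + v2! (k ∸ (suc a + len)))  ≡⟨ sym (ℕₚ.+-assoc (w k a) _ _) ⟩
  window k a (suc len) + v2! (k ∸ (suc a + len))       ≡⟨ cong (λ z → window k a (suc len) + v2! (k ∸ z)) (sym (ℕₚ.+-suc a len)) ⟩
  window k a (suc len) + v2! (k ∸ (a + suc len))       ∎
  where
  open ≡-Reasoning
  bound′ : suc a + len ≤ k
  bound′ = ℕₚ.≤-trans (ℕₚ.≤-reflexive (sym (ℕₚ.+-suc a len))) bound
  a<k : a < k
  a<k = ℕₚ.≤-trans (s≤s (ℕₚ.m≤m+n a len)) bound′
  k∸a≡suc : k ∸ a ≡ suc (k ∸ suc a)
  k∸a≡suc = ℕₚ.+-∸-assoc 1 a<k
  dist : ∣ k - a ∣ ≡ suc (k ∸ suc a)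
  dist = trans (ℕₚ.∣-∣-comm k a) (trans (ℕₚ.m≤n⇒∣m-n∣≡n∸m (ℕₚ.<⇒≤ a<k)) k∸a≡suc)

-- The linear factor 2k − 12t − 2 of factorBC k t.  When k = 6t + r with
-- r ≠ 1 it equals 2(r − 1) ≠ 0, and v₂ of it is 1 + v₂|k − (6t + 1)|.
linearFactor : ℕ → ℕ → ℤ
linearFactor k t = (+ (2 * k)) ℤ.- (+ (12 * t)) ℤ.- (+ 2)

linearFactor-v2 : ∀ s r → r ≢ 1 →
  let k = 6 * suc s + r in
  (0 < ℤ.∣ linearFactor k (suc s) ∣) × (v2ℕ ℤ.∣ linearFactor k (suc s) ∣ ≡ suc (w k (suc (6 * suc s))))
linearFactor-v2 s zero _ = subst Goal (sym value) (s≤s z≤n , cong (λ z → suc (v2ℕ z)) (sym dist))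
  where
  t = suc s
  Goal : ℤ → Set
  Goal y = (0 < ℤ.∣ y ∣) × (v2ℕ ℤ.∣ y ∣ ≡ suc (w (6 * t + 0) (suc (6 * t))))
  twice : ∀ t → 2 * (6 * t + 0) ≡ 12 * t
  twice = solve-∀
  cancel : ∀ x → x ℤ.- x ℤ.- + 2 ≡ ℤ.- (+ 2)
  cancel = ℤSolver.solve-∀
  value : linearFactor (6 * t + 0) t ≡ ℤ.- (+ 2)
  value = trans (cong (λ z → + z ℤ.- + (12 * t) ℤ.- + 2) (twice t)) (cancel (+ (12 * t)))
  dist : ∣ 6 * t + 0 - suc (6 * t) ∣ ≡ 1
  dist = trans (cong (λ z → ∣ z - suc (6 * t) ∣) (ℕₚ.+-identityʳ (6 * t))) (trans (cong (λ z → ∣ 6 * t - z ∣) (ℕₚ.+-comm 1 (6 * t))) (ℕₚ.∣m-m+n∣≡n (6 * t) 1))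
linearFactor-v2 s (suc zero) r≢1 = ⊥-elim (r≢1 refl)
linearFactor-v2 s (suc (suc r)) _ = subst Goal (sym value) (s≤s z≤n , trans (v2-even (suc r) (s≤s z≤n)) (cong (λ z → suc (v2ℕ z)) (sym dist)))
  where
  t = suc s
  k = 6 * t + suc (suc r)
  Goal : ℤ → Set
  Goal y = (0 < ℤ.∣ y ∣) × (v2ℕ ℤ.∣ y ∣ ≡ suc (w k (suc (6 * t))))
  twice : ∀ s r → 2 * (6 * suc s + suc (suc r)) ≡ 2 * suc r + (12 * suc s + 2)
  twice = solve-∀
  cancel : ∀ x y → x ℤ.+ (y ℤ.+ + 2) ℤ.- y ℤ.- + 2 ≡ x
  cancel = ℤSolver.solve-∀
  value : linearFactor k t ≡ + (2 * suc r)
  value = begin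
    + (2 * k) ℤ.- + (12 * t) ℤ.- + 2                              ≡⟨ cong (λ z → + z ℤ.- + (12 * t) ℤ.- + 2) (twice s r) ⟩
    + (2 * suc r + (12 * t + 2)) ℤ.- + (12 * t) ℤ.- + 2           ≡⟨ cong (λ z → z ℤ.- + (12 * t) ℤ.- + 2) (trans (ℤₚ.pos-+ (2 * suc r) _) (cong (λ z → + (2 * suc r) ℤ.+ z) (ℤₚ.pos-+ (12 * t) 2))) ⟩
    + (2 * suc r) ℤ.+ (+ (12 * t) ℤ.+ + 2) ℤ.- + (12 * t) ℤ.- + 2  ≡⟨ cancel (+ (2 * suc r)) (+ (12 * t)) ⟩
    + (2 * suc r)                                                  ∎
    where open ≡-Reasoning
  shift : ∀ s r → 6 * suc s + suc (suc r) ≡ suc (6 * suc s) + suc r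
  shift = solve-∀
  dist : ∣ k - suc (6 * t) ∣ ≡ suc r
  dist = trans (ℕₚ.∣-∣-comm k (suc (6 * t))) (trans (cong (λ z → ∣ suc (6 * t) - z ∣) (shift s r)) (ℕₚ.∣m-m+n∣≡n (suc (6 * t)) (suc r)))

≤-of-sum : ∀ a b {c} → c ≡ a + b → a ≤ c
≤-of-sum a b refl = ℕₚ.m≤m+n a b

∸-of-sum : ∀ a b {c} → c ≡ a + b → c ∸ b ≡ a
∸-of-sum a b refl = ℕₚ.m+n∸n≡m a b

-- The valuation of the j-th factor of P_BC at j = t = s + 1, for weight
-- parameter k = 6t + r with r ≠ 1 (so that the linear factor is nonzero):
--   v₂(factorBC k t) = 3t + window(4t, 2t) + w(6t + 1) − window(3t + 1, t + 1).
-- Writing A = 2k−8t, B = A−3, C = 2k−12t, E = 2k−6t−1 for the factorial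
-- arguments, each v₂(X!) is reduced by one halving step and one telescoping.
module FactorAt (s r : ℕ) where
  t k W₁ W₂ w₀ A B C E : ℕ
  t = suc s
  k = 6 * t + r
  W₁ = window k (4 * t) (2 * t)
  W₂ = window k (suc (3 * t)) (suc t)
  w₀ = w k (suc (6 * t))
  A = 2 * k ∸ 8 * t
  B = 2 * k ∸ 8 * t ∸ 3
  C = 2 * k ∸ 12 * t
  E = 2 * k ∸ 6 * t ∸ 1

  -- A = 2(2t + r) and (k − 4t) − 2t = r.
  v2!A : v2! A ≡ (2 * t + r) + (W₁ + v2! r)
  v2!A = begin
    v2! A                                        ≡⟨ cong v2! (∸-of-sum (2 * (2 * t + r)) (8 * t) (eq₁ s r)) ⟩
    v2! (2 * (2 * t + r))                        ≡⟨ v2!-even (2 * t + r) ⟩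
    (2 * t + r) + v2! (2 * t + r)                ≡⟨ cong (λ z → (2 * t + r) + v2! z) (sym (∸-of-sum (2 * t + r) (4 * t) (eq₂ s r))) ⟩
    (2 * t + r) + v2! (k ∸ 4 * t)                ≡⟨ cong (λ z → (2 * t + r) + z) (v2!-window k (2 * t) (4 * t) (≤-of-sum (4 * t + 2 * t) r (eq₃ s r))) ⟩
    (2 * t + r) + (W₁ + v2! (k ∸ (4 * t + 2 * t))) ≡⟨ cong (λ z → (2 * t + r) + (W₁ + v2! z)) (∸-of-sum r (4 * t + 2 * t) (eq₄ s r)) ⟩
    (2 * t + r) + (W₁ + v2! r)                   ∎
    where
    open ≡-Reasoning
    eq₁ : ∀ s r → 2 * (6 * suc s + r) ≡ 2 * (2 * suc s + r) + 8 * suc s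
    eq₁ = solve-∀
    eq₂ : ∀ s r → 6 * suc s + r ≡ 2 * suc s + r + 4 * suc s
    eq₂ = solve-∀
    eq₃ : ∀ s r → 6 * suc s + r ≡ (4 * suc s + 2 * suc s) + r
    eq₃ = solve-∀
    eq₄ : ∀ s r → 6 * suc s + r ≡ r + (4 * suc s + 2 * suc s)
    eq₄ = solve-∀

  -- B = 2(2s + r) + 1.
  v2!B : v2! B ≡ (2 * s + r) + v2! (2 * s + r)
  v2!B = trans (cong v2! (trans (cong (_∸ 3) (∸-of-sum (2 * (2 * t + r)) (8 * t) (eq₁ s r)))
                                (∸-of-sum (suc (2 * (2 * s + r))) 3 (eq₂ s r))))
               (v2!-odd (2 * s + r))
    where
    eq₁ : ∀ s r → 2 * (6 * suc s + r) ≡ 2 * (2 * suc s + r) + 8 * suc s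
    eq₁ = solve-∀
    eq₂ : ∀ s r → 2 * (2 * suc s + r) ≡ suc (2 * (2 * s + r)) + 3
    eq₂ = solve-∀

  -- C = 2r.
  v2!C : v2! C ≡ r + v2! r
  v2!C = trans (cong v2! (∸-of-sum (2 * r) (12 * t) (eq s r))) (v2!-even r)
    where
    eq : ∀ s r → 2 * (6 * suc s + r) ≡ 2 * r + 12 * suc s
    eq = solve-∀

  -- E = 2m + 1 with m = k − (3t + 1), and m − (t + 1) = 2s + r.
  v2!E : v2! E ≡ (3 * s + r + 2) + (W₂ + v2! (2 * s + r))
  v2!E = begin
    v2! E                                              ≡⟨ cong v2! (trans (cong (_∸ 1) (∸-of-sum (suc (2 * m) + 1) (6 * t) (eq₁ s r))) (∸-of-sum (suc (2 * m)) 1 refl)) ⟩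
    v2! (suc (2 * m))                                  ≡⟨ v2!-odd m ⟩
    m + v2! m                                          ≡⟨ cong (λ z → m + v2! z) (sym (∸-of-sum m (suc (3 * t)) (eq₂ s r))) ⟩
    m + v2! (k ∸ suc (3 * t))                          ≡⟨ cong (λ z → m + z) (v2!-window k (suc t) (suc (3 * t)) (≤-of-sum (suc (3 * t) + suc t) (2 * s + r) (eq₃ s r))) ⟩
    m + (W₂ + v2! (k ∸ (suc (3 * t) + suc t)))         ≡⟨ cong (λ z → m + (W₂ + v2! z)) (∸-of-sum (2 * s + r) (suc (3 * t) + suc t) (eq₄ s r)) ⟩
    m + (W₂ + v2! (2 * s + r))                         ∎
    where
    open ≡-Reasoning
    m = 3 * s + r + 2
    eq₁ : ∀ s r → 2 * (6 * suc s + r) ≡ (suc (2 * (3 * s + r + 2)) + 1) + 6 * suc s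
    eq₁ = solve-∀
    eq₂ : ∀ s r → 6 * suc s + r ≡ 3 * s + r + 2 + suc (3 * suc s)
    eq₂ = solve-∀
    eq₃ : ∀ s r → 6 * suc s + r ≡ (suc (3 * suc s) + suc (suc s)) + (2 * s + r)
    eq₃ = solve-∀
    eq₄ : ∀ s r → 6 * suc s + r ≡ (2 * s + r) + (suc (3 * suc s) + suc (suc s))
    eq₄ = solve-∀

  numerator : ℕ
  numerator = 2 ^ (2 * t) * A ! * B !

  head-pos : 0 < 2 ^ (2 * t) * A !
  head-pos = ℕₚ.*-mono-< {0} {2 ^ (2 * t)} {0} (ℕₚ.m^n>0 2 (2 * t)) (ℕₚ.1≤n! A)

  numerator-pos : 0 < numerator
  numerator-pos = ℕₚ.*-mono-< {0} {2 ^ (2 * t) * A !} {0} head-pos (ℕₚ.1≤n! B)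

  module _ (r≢1 : r ≢ 1) where
    private
      linear = linearFactor-v2 s r r≢1
      N≢0 : + numerator ℤ.* linearFactor k t ≢ + 0
      N≢0 = *-nonzero (+ numerator) (linearFactor k t)
              (λ e → ℕₚ.<-irrefl (sym (cong ℤ.∣_∣ e)) numerator-pos)
              (λ e → ℕₚ.<-irrefl (sym (cong ℤ.∣_∣ e)) (proj₁ linear))

    factor-nonzero : factorBC k t ≢ 0ℚ
    factor-nonzero = /-nonzero (+ numerator ℤ.* linearFactor k t) (C ! * E !) {{ℕₚ._!*_!≢0 C E}} N≢0

    private
      c : ℕ
      c = v2! r + v2! (2 * s + r) + r + (3 * s + r + 2)

      v2-num : v2ℕ ℤ.∣ + numerator ℤ.* linearFactor k t ∣ ≡ (3 * t + W₁ + w₀) + c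
      v2-num = begin
        v2ℕ ℤ.∣ + numerator ℤ.* linearFactor k t ∣
          ≡⟨ cong v2ℕ (ℤₚ.abs-* (+ numerator) (linearFactor k t)) ⟩
        v2ℕ (numerator * ℤ.∣ linearFactor k t ∣)
          ≡⟨ v2-mul numerator _ numerator-pos (proj₁ linear) ⟩
        v2ℕ (2 ^ (2 * t) * A ! * B !) + v2ℕ ℤ.∣ linearFactor k t ∣
          ≡⟨ cong (_+ v2ℕ ℤ.∣ linearFactor k t ∣) (v2-mul (2 ^ (2 * t) * A !) (B !) head-pos (ℕₚ.1≤n! B)) ⟩
        (v2ℕ (2 ^ (2 * t) * A !) + v2! B) + v2ℕ ℤ.∣ linearFactor k t ∣
          ≡⟨ cong₂ (λ x y → (x + v2! B) + y) (v2-pow (2 * t) (A !) (ℕₚ.1≤n! A)) (proj₂ linear) ⟩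
        (2 * t + v2! A + v2! B) + suc w₀
          ≡⟨ cong₂ (λ x y → (2 * t + x + y) + suc w₀) v2!A v2!B ⟩
        (2 * t + ((2 * t + r) + (W₁ + v2! r)) + ((2 * s + r) + v2! (2 * s + r))) + suc w₀
          ≡⟨ collect s r W₁ (v2! r) (v2! (2 * s + r)) w₀ ⟩
        (3 * t + W₁ + w₀) + c
          ∎
        where
        open ≡-Reasoning
        collect : ∀ s r W₁ x y w₀ → (2 * suc s + ((2 * suc s + r) + (W₁ + x)) + ((2 * s + r) + y)) + suc w₀
                                    ≡ (3 * suc s + W₁ + w₀) + (x + y + r + (3 * s + r + 2))
        collect = solve-∀

      v2-den : v2ℕ (C ! * E !) ≡ W₂ + c
      v2-den = begin
        v2ℕ (C ! * E !)                                          ≡⟨ v2-mul (C !) (E !) (ℕₚ.1≤n! C) (ℕₚ.1≤n! E) ⟩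
        v2! C + v2! E                                            ≡⟨ cong₂ _+_ v2!C v2!E ⟩
        (r + v2! r) + ((3 * s + r + 2) + (W₂ + v2! (2 * s + r))) ≡⟨ collect s r W₂ (v2! r) (v2! (2 * s + r)) ⟩
        W₂ + c                                                   ∎
        where
        open ≡-Reasoning
        collect : ∀ s r W₂ x y → (r + x) + ((3 * s + r + 2) + (W₂ + y)) ≡ W₂ + (x + y + r + (3 * s + r + 2))
        collect = solve-∀

    factor-v2 : v2ℚ (factorBC k t) ≡ + (3 * t + W₁ + w₀) ℤ.- + W₂
    factor-v2 = begin
      v2ℚ (factorBC k t)                                              ≡⟨ v2ℚ-/ (+ numerator ℤ.* linearFactor k t) (C ! * E !) {{ℕₚ._!*_!≢0 C E}} N≢0 ⟩
      + v2ℕ ℤ.∣ + numerator ℤ.* linearFactor k t ∣ ℤ.- + v2ℕ (C ! * E !) ≡⟨ cong₂ (λ x y → + x ℤ.- + y) v2-num v2-den ⟩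
      + ((3 * t + W₁ + w₀) + c) ℤ.- + (W₂ + c)                        ≡⟨ +-cancel-diff (3 * t + W₁ + w₀) W₂ c ⟩
      + (3 * t + W₁ + w₀) ℤ.- + W₂                                    ∎
      where open ≡-Reasoning

Σ< : (ℕ → ℤ) → ℕ → ℤ
Σ< f zero    = + 0
Σ< f (suc L) = Σ< f L ℤ.+ f L

Σ₁ : (ℕ → ℤ) → ℕ → ℤ
Σ₁ f n = Σ< (λ t → f (suc t)) n

Σ<-cong : ∀ {f g} L → (∀ ℓ → ℓ < L → f ℓ ≡ g ℓ) → Σ< f L ≡ Σ< g L
Σ<-cong zero    _  = refl
Σ<-cong (suc L) eq = cong₂ ℤ._+_ (Σ<-cong L (λ ℓ ℓ<L → eq ℓ (ℕₚ.m≤n⇒m≤1+n ℓ<L))) (eq L ℕₚ.≤-refl)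

Σ<-zero : ∀ f L → (∀ ℓ → ℓ < L → f ℓ ≡ + 0) → Σ< f L ≡ + 0
Σ<-zero f zero    _  = refl
Σ<-zero f (suc L) eq = cong₂ ℤ._+_ (Σ<-zero f L (λ ℓ ℓ<L → eq ℓ (ℕₚ.m≤n⇒m≤1+n ℓ<L))) (eq L ℕₚ.≤-refl)

Σ<-+ : ∀ f g L → Σ< (λ ℓ → f ℓ ℤ.+ g ℓ) L ≡ Σ< f L ℤ.+ Σ< g L
Σ<-+ f g zero    = refl
Σ<-+ f g (suc L) = trans (cong (ℤ._+ (f L ℤ.+ g L)) (Σ<-+ f g L)) (interchange (Σ< f L) (Σ< g L) (f L) (g L))
  where
  interchange : ∀ a b c d → (a ℤ.+ b) ℤ.+ (c ℤ.+ d) ≡ (a ℤ.+ c) ℤ.+ (b ℤ.+ d)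
  interchange = ℤSolver.solve-∀

Σ<-- : ∀ f g L → Σ< (λ ℓ → f ℓ ℤ.- g ℓ) L ≡ Σ< f L ℤ.- Σ< g L
Σ<-- f g zero    = refl
Σ<-- f g (suc L) = trans (cong (ℤ._+ (f L ℤ.- g L)) (Σ<-- f g L)) (interchange (Σ< f L) (Σ< g L) (f L) (g L))
  where
  interchange : ∀ a b c d → (a ℤ.- b) ℤ.+ (c ℤ.- d) ≡ (a ℤ.+ c) ℤ.- (b ℤ.+ d)
  interchange = ℤSolver.solve-∀

Σ<-nonneg : ∀ f L → (∀ ℓ → ℓ < L → + 0 ℤ.≤ f ℓ) → + 0 ℤ.≤ Σ< f L
Σ<-nonneg f zero    _   = ℤₚ.≤-refl
Σ<-nonneg f (suc L) pos = ℤₚ.+-mono-≤ (Σ<-nonneg f L (λ ℓ ℓ<L → pos ℓ (ℕₚ.m≤n⇒m≤1+n ℓ<L))) (pos L ℕₚ.≤-refl)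

Σ<-split : ∀ f a b → Σ< f (a + b) ≡ Σ< f a ℤ.+ Σ< (λ d → f (a + d)) b
Σ<-split f a zero    = trans (cong (Σ< f) (ℕₚ.+-identityʳ a)) (sym (ℤₚ.+-identityʳ _))
Σ<-split f a (suc b) = trans (cong (Σ< f) (ℕₚ.+-suc a b))
  (trans (cong (ℤ._+ f (a + b)) (Σ<-split f a b)) (ℤₚ.+-assoc (Σ< f a) _ _))

Σ₁-cong : ∀ {f g} n → (∀ t → 1 ≤ t → t ≤ n → f t ≡ g t) → Σ₁ f n ≡ Σ₁ g n
Σ₁-cong n eq = Σ<-cong n (λ ℓ ℓ<n → eq (suc ℓ) (s≤s z≤n) ℓ<n)

Σ₁-zero : ∀ f n → (∀ t → 1 ≤ t → t ≤ n → f t ≡ + 0) → Σ₁ f n ≡ + 0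
Σ₁-zero f n eq = Σ<-zero _ n (λ ℓ ℓ<n → eq (suc ℓ) (s≤s z≤n) ℓ<n)

Σ₁-nonneg : ∀ f n → (∀ t → + 0 ℤ.≤ f t) → + 0 ℤ.≤ Σ₁ f n
Σ₁-nonneg f n pos = Σ<-nonneg _ n (λ ℓ _ → pos (suc ℓ))

𝟙 : ∀ {P : Set} → Dec P → ℤ
𝟙 (yes _) = + 1
𝟙 (no _)  = + 0

𝟙-cong : ∀ {P Q : Set} (p : Dec P) (q : Dec Q) → (P → Q) → (Q → P) → 𝟙 p ≡ 𝟙 q
𝟙-cong (yes _) (yes _) _   _   = refl
𝟙-cong (yes p) (no ¬q) p→q _   = ⊥-elim (¬q (p→q p))
𝟙-cong (no ¬p) (yes q) _   q→p = ⊥-elim (¬p (q→p q))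
𝟙-cong (no _)  (no _)  _   _   = refl

𝟙-nonneg : ∀ {P : Set} (p : Dec P) → + 0 ℤ.≤ 𝟙 p
𝟙-nonneg (yes _) = ℤ.+≤+ z≤n
𝟙-nonneg (no _)  = ℤ.+≤+ z≤n

range? : ∀ a b ℓ → Dec (a ≤ ℓ × ℓ < b)
range? a b ℓ = (a ℕ.≤? ℓ) ×-dec (ℓ ℕ.<? b)

inRange : ℕ → ℕ → ℕ → ℤ
inRange a b ℓ = 𝟙 (range? a b ℓ)

atPoint : ℕ → ℕ → ℤ
atPoint b ℓ = 𝟙 (ℓ ℕ.≟ b)

weighted : (ℕ → ℤ) → (ℕ → ℤ) → ℕ → ℤ
weighted wt c L = Σ< (λ ℓ → c ℓ ℤ.* wt ℓ) L

weighted-+ : ∀ wt f g L → weighted wt (λ ℓ → f ℓ ℤ.+ g ℓ) L ≡ weighted wt f L ℤ.+ weighted wt g L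
weighted-+ wt f g L = trans (Σ<-cong L (λ ℓ _ → ℤₚ.*-distribʳ-+ (wt ℓ) (f ℓ) (g ℓ))) (Σ<-+ _ _ L)

weighted-- : ∀ wt f g L → weighted wt (λ ℓ → f ℓ ℤ.- g ℓ) L ≡ weighted wt f L ℤ.- weighted wt g L
weighted-- wt f g L = trans (Σ<-cong L (λ ℓ _ → distrib (f ℓ) (g ℓ) (wt ℓ))) (Σ<-- _ _ L)
  where
  distrib : ∀ a b c → (a ℤ.- b) ℤ.* c ≡ a ℤ.* c ℤ.- b ℤ.* c
  distrib = ℤSolver.solve-∀

weighted-point : ∀ wt b L → b < L → weighted wt (atPoint b) L ≡ wt b
weighted-point wt b zero    ()
weighted-point wt b (suc L) b<1+L with b ℕ.≟ L
... | yes refl = trans (cong₂ ℤ._+_ (Σ<-zero _ b (λ ℓ ℓ<b → off ℓ (ℕₚ.<⇒≢ ℓ<b))) on) (ℤₚ.+-identityˡ _)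
  where
  off : ∀ ℓ → ℓ ≢ b → atPoint b ℓ ℤ.* wt ℓ ≡ + 0
  off ℓ ℓ≢b with ℓ ℕ.≟ b
  ... | yes ℓ≡b = ⊥-elim (ℓ≢b ℓ≡b)
  ... | no _    = ℤₚ.*-zeroˡ (wt ℓ)
  on : atPoint b b ℤ.* wt b ≡ wt b
  on with b ℕ.≟ b
  ... | yes _   = ℤₚ.*-identityˡ (wt b)
  ... | no b≢b  = ⊥-elim (b≢b refl)
... | no b≢L = trans (cong₂ ℤ._+_ (weighted-point wt b L (ℕₚ.≤∧≢⇒< (ℕₚ.≤-pred b<1+L) b≢L)) off) (ℤₚ.+-identityʳ _)
  where
  off : atPoint b L ℤ.* wt L ≡ + 0
  off with L ℕ.≟ b
  ... | yes L≡b = ⊥-elim (b≢L (sym L≡b))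
  ... | no _    = ℤₚ.*-zeroˡ (wt L)

inRange-split : ∀ a len ℓ → inRange a (a + suc len) ℓ ≡ atPoint a ℓ ℤ.+ inRange (suc a) (suc a + len) ℓ
inRange-split a len ℓ with ℓ ℕ.≟ a
... | yes refl = begin
  inRange ℓ (ℓ + suc len) ℓ                ≡⟨ 𝟙-cong (range? ℓ (ℓ + suc len) ℓ) (yes tt) (λ _ → tt) (λ _ → ℕₚ.≤-refl , ℕₚ.≤-trans (ℕₚ.m≤m+n (suc ℓ) len) (ℕₚ.≤-reflexive (sym (ℕₚ.+-suc ℓ len)))) ⟩
  + 1 ℤ.+ + 0                              ≡⟨ cong (λ z → + 1 ℤ.+ z) (𝟙-cong (no (λ ())) (range? (suc ℓ) (suc ℓ + len) ℓ) (λ ()) (λ inside → ℕₚ.<-irrefl refl (proj₁ inside))) ⟩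
  + 1 ℤ.+ inRange (suc ℓ) (suc ℓ + len) ℓ  ∎
  where open ≡-Reasoning
... | no ℓ≢a = trans (𝟙-cong (range? a (a + suc len) ℓ) (range? (suc a) (suc a + len) ℓ) shrink widen) (sym (ℤₚ.+-identityˡ _))
  where
  shrink : (a ≤ ℓ × ℓ < a + suc len) → (suc a ≤ ℓ × ℓ < suc a + len)
  shrink (a≤ℓ , ℓ<) = ℕₚ.≤∧≢⇒< a≤ℓ (λ e → ℓ≢a (sym e)) , ℕₚ.<-≤-trans ℓ< (ℕₚ.≤-reflexive (ℕₚ.+-suc a len))
  widen : (suc a ≤ ℓ × ℓ < suc a + len) → (a ≤ ℓ × ℓ < a + suc len)
  widen (a<ℓ , ℓ<) = ℕₚ.<⇒≤ a<ℓ , ℕₚ.<-≤-trans ℓ< (ℕₚ.≤-reflexive (sym (ℕₚ.+-suc a len)))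

weight : ℕ → ℕ → ℤ
weight k ℓ = + w k ℓ

window-weighted : ∀ k len a L → a + len ≤ L →
  + window k a len ≡ weighted (weight k) (inRange a (a + len)) L
window-weighted k zero a L _ = sym (Σ<-zero _ L (λ ℓ _ → trans (cong (ℤ._* + w k ℓ) empty) (ℤₚ.*-zeroˡ (+ w k ℓ))))
  where
  empty : ∀ {ℓ} → inRange a (a + 0) ℓ ≡ + 0
  empty {ℓ} = 𝟙-cong (range? a (a + 0) ℓ) (no (λ ())) (λ (a≤ℓ , ℓ<a+0) → ℕₚ.<-irrefl refl (ℕₚ.<-≤-trans ℓ<a+0 (ℕₚ.≤-trans (ℕₚ.≤-reflexive (ℕₚ.+-identityʳ a)) a≤ℓ))) (λ ())
window-weighted k (suc len) a L bound = begin
  + (w k a + window k (suc a) len)                                         ≡⟨ ℤₚ.pos-+ (w k a) _ ⟩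
  + w k a ℤ.+ + window k (suc a) len                                       ≡⟨ cong₂ ℤ._+_ (sym (weighted-point wk a L a<L)) (window-weighted k len (suc a) L bound′) ⟩
  weighted wk (atPoint a) L ℤ.+ weighted wk (inRange (suc a) (suc a + len)) L ≡⟨ sym (weighted-+ wk (atPoint a) (inRange (suc a) (suc a + len)) L) ⟩
  weighted wk (λ ℓ → atPoint a ℓ ℤ.+ inRange (suc a) (suc a + len) ℓ) L   ≡⟨ Σ<-cong L (λ ℓ _ → cong (ℤ._* wk ℓ) (sym (inRange-split a len ℓ))) ⟩
  weighted wk (inRange a (a + suc len)) L                                  ∎
  where
  open ≡-Reasoning
  wk = weight k
  bound′ : suc a + len ≤ L
  bound′ = ℕₚ.≤-trans (ℕₚ.≤-reflexive (sym (ℕₚ.+-suc a len))) bound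
  a<L : a < L
  a<L = ℕₚ.≤-trans (s≤s (ℕₚ.m≤m+n a len)) bound′

-- Coefficient of w(ℓ) in v₂ of the t-th factor, by FactorAt:
--   [4t ≤ ℓ < 6t] + [ℓ = 6t + 1] − [3t + 1 ≤ ℓ < 4t + 2],
-- and its partial sums over t = 1 … n, the coefficients for the product.
factorCoeff : ℕ → ℕ → ℤ
factorCoeff t ℓ = inRange (4 * t) (4 * t + 2 * t) ℓ ℤ.+ atPoint (suc (6 * t)) ℓ ℤ.- inRange (suc (3 * t)) (suc (3 * t) + suc t) ℓ

prodCoeff : ℕ → ℕ → ℤ
prodCoeff n ℓ = Σ₁ (λ t → factorCoeff t ℓ) n

triangle : ℕ → ℤ
triangle n = Σ₁ (λ t → + (3 * t)) n

-- t is admissible for k when k = 6t + r with r ≠ 1 (the linear factor is nonzero).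
Admissible : ℕ → ℕ → Set
Admissible k t = Σ ℕ λ r → (k ≡ 6 * t + r) × (r ≢ 1)

factor-linear : ∀ k t L → 1 ≤ t → Admissible k t → 6 * t + 2 ≤ L →
  (factorBC k t ≢ 0ℚ) × (v2ℚ (factorBC k t) ≡ + (3 * t) ℤ.+ weighted (weight k) (factorCoeff t) L)
factor-linear k (suc s) L _ (r , refl , r≢1) L≥ = FactorAt.factor-nonzero s r r≢1 , trans (FactorAt.factor-v2 s r r≢1) regroup
  where
  open FactorAt s r using (t; W₁; W₂; w₀)
  wt = weight (6 * t + r)
  f₁ = inRange (4 * t) (4 * t + 2 * t)
  f₂ = atPoint (suc (6 * t))
  f₃ = inRange (suc (3 * t)) (suc (3 * t) + suc t)
  bound₁ : ∀ s → 4 * suc s + 2 * suc s ≤ 6 * suc s + 2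
  bound₁ s = ≤-of-sum (4 * suc s + 2 * suc s) 2 (eq s)
    where eq : ∀ s → 6 * suc s + 2 ≡ 4 * suc s + 2 * suc s + 2
          eq = solve-∀
  bound₂ : ∀ s → suc (6 * suc s) < 6 * suc s + 2
  bound₂ s = ≤-of-sum (suc (suc (6 * suc s))) 0 (eq s)
    where eq : ∀ s → 6 * suc s + 2 ≡ suc (suc (6 * suc s)) + 0
          eq = solve-∀
  bound₃ : ∀ s → suc (3 * suc s) + suc (suc s) ≤ 6 * suc s + 2
  bound₃ s = ≤-of-sum (suc (3 * suc s) + suc (suc s)) (2 * s + 2) (eq s)
    where eq : ∀ s → 6 * suc s + 2 ≡ suc (3 * suc s) + suc (suc s) + (2 * s + 2)
          eq = solve-∀
  regroup : + (3 * t + W₁ + w₀) ℤ.- + W₂ ≡ + (3 * t) ℤ.+ weighted wt (factorCoeff t) L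
  regroup = begin
    + (3 * t + W₁ + w₀) ℤ.- + W₂
      ≡⟨ cong (ℤ._- + W₂) (trans (ℤₚ.pos-+ (3 * t + W₁) w₀) (cong (ℤ._+ + w₀) (ℤₚ.pos-+ (3 * t) W₁))) ⟩
    + (3 * t) ℤ.+ + W₁ ℤ.+ + w₀ ℤ.- + W₂
      ≡⟨ cong₂ (λ a b → + (3 * t) ℤ.+ a ℤ.+ b ℤ.- + W₂) (window-weighted (6 * t + r) (2 * t) (4 * t) L (ℕₚ.≤-trans (bound₁ s) L≥))
                                                        (sym (weighted-point wt (suc (6 * t)) L (ℕₚ.<-≤-trans (bound₂ s) L≥))) ⟩
    + (3 * t) ℤ.+ weighted wt f₁ L ℤ.+ weighted wt f₂ L ℤ.- + W₂
      ≡⟨ cong (λ z → + (3 * t) ℤ.+ weighted wt f₁ L ℤ.+ weighted wt f₂ L ℤ.- z) (window-weighted (6 * t + r) (suc t) (suc (3 * t)) L (ℕₚ.≤-trans (bound₃ s) L≥)) ⟩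
    + (3 * t) ℤ.+ weighted wt f₁ L ℤ.+ weighted wt f₂ L ℤ.- weighted wt f₃ L
      ≡⟨ reassoc (+ (3 * t)) (weighted wt f₁ L) (weighted wt f₂ L) (weighted wt f₃ L) ⟩
    + (3 * t) ℤ.+ ((weighted wt f₁ L ℤ.+ weighted wt f₂ L) ℤ.- weighted wt f₃ L)
      ≡⟨ cong (λ z → + (3 * t) ℤ.+ (z ℤ.- weighted wt f₃ L)) (sym (weighted-+ wt f₁ f₂ L)) ⟩
    + (3 * t) ℤ.+ (weighted wt (λ ℓ → f₁ ℓ ℤ.+ f₂ ℓ) L ℤ.- weighted wt f₃ L)
      ≡⟨ cong (λ z → + (3 * t) ℤ.+ z) (sym (weighted-- wt (λ ℓ → f₁ ℓ ℤ.+ f₂ ℓ) f₃ L)) ⟩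
    + (3 * t) ℤ.+ weighted wt (factorCoeff t) L
      ∎
    where
    open ≡-Reasoning
    reassoc : ∀ a b c d → a ℤ.+ b ℤ.+ c ℤ.- d ≡ a ℤ.+ ((b ℤ.+ c) ℤ.- d)
    reassoc = ℤSolver.solve-∀

prod-linear : ∀ k n L → (∀ t → 1 ≤ t → t ≤ n → Admissible k t) → 6 * n + 2 ≤ L →
  (prodBC k n ≢ 0ℚ) × (v2ℚ (prodBC k n) ≡ triangle n ℤ.+ weighted (weight k) (prodCoeff n) L)
prod-linear k zero L _ _ = (λ ()) , sym (trans (ℤₚ.+-identityˡ _) (Σ<-zero _ L (λ ℓ _ → ℤₚ.*-zeroˡ (weight k ℓ))))
prod-linear k (suc n) L adm L≥ =
  *-nonzeroℚ _ _ (proj₁ IH) (proj₁ last) ,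
  (begin
    v2ℚ (prodBC k n ℚ.* factorBC k (suc n))
      ≡⟨ v2ℚ-* _ _ (proj₁ IH) (proj₁ last) ⟩
    v2ℚ (prodBC k n) ℤ.+ v2ℚ (factorBC k (suc n))
      ≡⟨ cong₂ ℤ._+_ (proj₂ IH) (proj₂ last) ⟩
    (triangle n ℤ.+ weighted wt (prodCoeff n) L) ℤ.+ (+ (3 * suc n) ℤ.+ weighted wt (factorCoeff (suc n)) L)
      ≡⟨ interchange (triangle n) (weighted wt (prodCoeff n) L) (+ (3 * suc n)) (weighted wt (factorCoeff (suc n)) L) ⟩
    triangle (suc n) ℤ.+ (weighted wt (prodCoeff n) L ℤ.+ weighted wt (factorCoeff (suc n)) L)
      ≡⟨ cong (λ z → triangle (suc n) ℤ.+ z) (sym (weighted-+ wt (prodCoeff n) (factorCoeff (suc n)) L)) ⟩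
    triangle (suc n) ℤ.+ weighted wt (prodCoeff (suc n)) L
      ∎)
  where
  open ≡-Reasoning
  wt = weight k
  L≥′ : 6 * n + 2 ≤ L
  L≥′ = ℕₚ.≤-trans (ℕₚ.+-monoˡ-≤ 2 (ℕₚ.*-monoʳ-≤ 6 (ℕₚ.n≤1+n n))) L≥
  IH = prod-linear k n L (λ t 1≤t t≤n → adm t 1≤t (ℕₚ.m≤n⇒m≤1+n t≤n)) L≥′
  last = factor-linear k (suc n) L (s≤s z≤n) (adm (suc n) (s≤s z≤n) ℕₚ.≤-refl) L≥
  interchange : ∀ a b c d → (a ℤ.+ b) ℤ.+ (c ℤ.+ d) ≡ (a ℤ.+ c) ℤ.+ (b ℤ.+ d)
  interchange = ℤSolver.solve-∀

between? : ∀ lo hi t → Dec (lo < t × t ≤ hi)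
between? lo hi t = (lo ℕ.<? t) ×-dec (t ℕ.≤? hi)

count : ℕ → ℕ → ℕ → ℤ
count lo hi n = Σ₁ (λ t → 𝟙 (between? lo hi t)) n

private
  count-step : ∀ {c i : ℤ} {x y x′ y′ b Δx Δy : ℕ} → c ℤ.+ + x ≡ + y → i ≡ + b →
               x′ ≡ x + Δx → y′ ≡ y + Δy → b + Δx ≡ Δy → c ℤ.+ i ℤ.+ + x′ ≡ + y′
  count-step {c} {x = x} {y} {b = b} {Δx} inv refl refl refl refl = begin
    c ℤ.+ + b ℤ.+ + (x + Δx)           ≡⟨ cong (λ z → c ℤ.+ + b ℤ.+ z) (ℤₚ.pos-+ x Δx) ⟩
    c ℤ.+ + b ℤ.+ (+ x ℤ.+ + Δx)       ≡⟨ regroup c (+ b) (+ x) (+ Δx) ⟩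
    (c ℤ.+ + x) ℤ.+ (+ b ℤ.+ + Δx)     ≡⟨ cong₂ ℤ._+_ inv (sym (ℤₚ.pos-+ b Δx)) ⟩
    + y ℤ.+ + (b + Δx)                 ≡⟨ sym (ℤₚ.pos-+ y (b + Δx)) ⟩
    + (y + (b + Δx))                   ∎
    where
    open ≡-Reasoning
    regroup : ∀ c b x d → c ℤ.+ b ℤ.+ (x ℤ.+ d) ≡ (c ℤ.+ x) ℤ.+ (b ℤ.+ d)
    regroup = ℤSolver.solve-∀

  ⊓-grow : ∀ {n m} → n < m → suc n ⊓ m ≡ n ⊓ m + 1
  ⊓-grow {n} n<m = trans (ℕₚ.m≤n⇒m⊓n≡m n<m) (trans (ℕₚ.+-comm 1 n) (cong (_+ 1) (sym (ℕₚ.m≤n⇒m⊓n≡m (ℕₚ.<⇒≤ n<m)))))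

  ⊓-stay : ∀ {n m} → m ≤ n → suc n ⊓ m ≡ n ⊓ m + 0
  ⊓-stay m≤n = trans (ℕₚ.m≥n⇒m⊓n≡n (ℕₚ.m≤n⇒m≤1+n m≤n)) (sym (trans (ℕₚ.+-identityʳ _) (ℕₚ.m≥n⇒m⊓n≡n m≤n)))

count-min : ∀ lo hi n → lo ≤ hi → count lo hi n ℤ.+ + (n ⊓ lo) ≡ + (n ⊓ hi)
count-min lo hi zero    _     = refl
count-min lo hi (suc n) lo≤hi with ℕₚ.<-≤-connex n lo | ℕₚ.<-≤-connex n hi
... | inj₁ n<lo | _ = count-step {c = count lo hi n} {i = 𝟙 (between? lo hi (suc n))} (count-min lo hi n lo≤hi)
      (𝟙-cong (between? lo hi (suc n)) (no (λ ())) (λ (lo<1+n , _) → ℕₚ.<-irrefl refl (ℕₚ.<-≤-trans lo<1+n n<lo)) (λ ()))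
      (⊓-grow n<lo) (⊓-grow (ℕₚ.<-≤-trans n<lo lo≤hi)) refl
... | inj₂ lo≤n | inj₁ n<hi = count-step {c = count lo hi n} {i = 𝟙 (between? lo hi (suc n))} (count-min lo hi n lo≤hi)
      (𝟙-cong (between? lo hi (suc n)) (yes tt) (λ _ → tt) (λ _ → s≤s lo≤n , n<hi))
      (⊓-stay lo≤n) (⊓-grow n<hi) refl
... | inj₂ lo≤n | inj₂ hi≤n = count-step {c = count lo hi n} {i = 𝟙 (between? lo hi (suc n))} (count-min lo hi n lo≤hi)
      (𝟙-cong (between? lo hi (suc n)) (no (λ ())) (λ (_ , 1+n≤hi) → ℕₚ.<-irrefl refl (ℕₚ.<-≤-trans 1+n≤hi hi≤n)) (λ ()))
      (⊓-stay lo≤n) (⊓-stay hi≤n) refl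

count-closed : ∀ lo hi n → lo ≤ hi → count lo hi n ≡ + (n ⊓ hi) ℤ.- + (n ⊓ lo)
count-closed lo hi n lo≤hi = solve-for (count-min lo hi n lo≤hi)
  where
  cancel : ∀ a b → a ≡ (a ℤ.+ b) ℤ.- b
  cancel = ℤSolver.solve-∀
  solve-for : ∀ {a b c} → a ℤ.+ b ≡ c → a ≡ c ℤ.- b
  solve-for {a} {b} refl = cancel a b

*≤⇒≤/ : ∀ t m d .{{_ : NonZero d}} → t * d ≤ m → t ≤ m / d
*≤⇒≤/ t m d td≤m = ℕₚ.≤-trans (ℕₚ.≤-reflexive (sym (ℕ÷.m*n/n≡m t d))) (ℕ÷./-monoˡ-≤ d td≤m)

≤/⇒*≤ : ∀ t m d .{{_ : NonZero d}} → t ≤ m / d → t * d ≤ m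
≤/⇒*≤ t m d t≤m/d = ℕₚ.≤-trans (ℕₚ.*-monoˡ-≤ d t≤m/d) (ℕ÷.m/n*n≤m m d)

<*⇒/< : ∀ t m d .{{_ : NonZero d}} → m < t * d → m / d < t
<*⇒/< t m d = ℕ÷.m<n*o⇒m/o<n

/<⇒<* : ∀ t m d .{{_ : NonZero d}} → m / d < t → m < t * d
/<⇒<* t m d m/d<t = ℕₚ.≰⇒> (λ td≤m → ℕₚ.<⇒≱ m/d<t (*≤⇒≤/ t m d td≤m))

⌊ℓ/6⌋ ⌊ℓ/4⌋ ⌊ℓ-2/4⌋ ⌊ℓ-1/3⌋ : ℕ → ℕ
⌊ℓ/6⌋ ℓ   = ℓ / 6
⌊ℓ/4⌋ ℓ   = ℓ / 4
⌊ℓ-2/4⌋ ℓ = (ℓ ∸ 2) / 4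
⌊ℓ-1/3⌋ ℓ = (ℓ ∸ 1) / 3

upper-window-count : ∀ ℓ t → inRange (4 * t) (4 * t + 2 * t) ℓ ≡ 𝟙 (between? (⌊ℓ/6⌋ ℓ) (⌊ℓ/4⌋ ℓ) t)
upper-window-count ℓ t = 𝟙-cong (range? (4 * t) (4 * t + 2 * t) ℓ) (between? (⌊ℓ/6⌋ ℓ) (⌊ℓ/4⌋ ℓ) t) to from
  where
  four : 4 * t ≡ t * 4
  four = ℕₚ.*-comm 4 t
  six : 4 * t + 2 * t ≡ t * 6
  six = eq t
    where eq : ∀ t → 4 * t + 2 * t ≡ t * 6
          eq = solve-∀
  to : 4 * t ≤ ℓ × ℓ < 4 * t + 2 * t → ⌊ℓ/6⌋ ℓ < t × t ≤ ⌊ℓ/4⌋ ℓ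
  to (lo , hi) = <*⇒/< t ℓ 6 (subst (ℓ <_) six hi) , *≤⇒≤/ t ℓ 4 (subst (_≤ ℓ) four lo)
  from : ⌊ℓ/6⌋ ℓ < t × t ≤ ⌊ℓ/4⌋ ℓ → 4 * t ≤ ℓ × ℓ < 4 * t + 2 * t
  from (lo , hi) = subst (_≤ ℓ) (sym four) (≤/⇒*≤ t ℓ 4 hi) , subst (ℓ <_) (sym six) (/<⇒<* t ℓ 6 lo)

lower-window-count : ∀ ℓ t → 1 ≤ t →
  inRange (suc (3 * t)) (suc (3 * t) + suc t) ℓ ≡ 𝟙 (between? (⌊ℓ-2/4⌋ ℓ) (⌊ℓ-1/3⌋ ℓ) t)
lower-window-count ℓ t 1≤t = 𝟙-cong (range? (suc (3 * t)) (suc (3 * t) + suc t) ℓ) (between? (⌊ℓ-2/4⌋ ℓ) (⌊ℓ-1/3⌋ ℓ) t) to from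
  where
  end : ∀ t → suc (3 * t) + suc t ≡ 2 + t * 4
  end = solve-∀
  lo-to : suc (3 * t) ≤ ℓ → t * 3 ≤ ℓ ∸ 1
  lo-to lo = subst (_≤ ℓ ∸ 1) (ℕₚ.*-comm 3 t) (ℕₚ.∸-monoˡ-≤ 1 lo)
  lo-from : ∀ ℓ → t * 3 ≤ ℓ ∸ 1 → suc (3 * t) ≤ ℓ
  lo-from zero     le = ⊥-elim (ℕₚ.<-irrefl refl (ℕₚ.≤-trans (ℕₚ.*-mono-≤ 1≤t (s≤s (z≤n {2}))) le))
  lo-from (suc ℓ′) le = s≤s (subst (_≤ ℓ′) (ℕₚ.*-comm t 3) le)
  hi-to : ∀ ℓ → ℓ < suc (3 * t) + suc t → ℓ ∸ 2 < t * 4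
  hi-to zero             _  = ℕₚ.*-mono-≤ 1≤t (s≤s (z≤n {3}))
  hi-to (suc zero)       _  = ℕₚ.*-mono-≤ 1≤t (s≤s (z≤n {3}))
  hi-to (suc (suc ℓ′))   hi = ℕₚ.≤-pred (ℕₚ.≤-pred (subst (suc (suc ℓ′) <_) (end t) hi))
  hi-from : ∀ ℓ → ℓ ∸ 2 < t * 4 → ℓ < suc (3 * t) + suc t
  hi-from zero           _  = subst (0 <_) (sym (end t)) (s≤s z≤n)
  hi-from (suc zero)     _  = subst (1 <_) (sym (end t)) (s≤s (s≤s z≤n))
  hi-from (suc (suc ℓ′)) hi = subst (suc (suc ℓ′) <_) (sym (end t)) (s≤s (s≤s hi))
  to : suc (3 * t) ≤ ℓ × ℓ < suc (3 * t) + suc t → ⌊ℓ-2/4⌋ ℓ < t × t ≤ ⌊ℓ-1/3⌋ ℓ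
  to (lo , hi) = <*⇒/< t (ℓ ∸ 2) 4 (hi-to ℓ hi) , *≤⇒≤/ t (ℓ ∸ 1) 3 (lo-to lo)
  from : ⌊ℓ-2/4⌋ ℓ < t × t ≤ ⌊ℓ-1/3⌋ ℓ → suc (3 * t) ≤ ℓ × ℓ < suc (3 * t) + suc t
  from (lo , hi) = lo-from ℓ (≤/⇒*≤ t (ℓ ∸ 1) 3 hi) , hi-from ℓ (/<⇒<* t (ℓ ∸ 2) 4 lo)

pointCount : ℕ → ℕ → ℤ
pointCount n ℓ = Σ₁ (λ t → atPoint (suc (6 * t)) ℓ) n

1+6t%6 : ∀ t → suc (6 * t) % 6 ≡ 1
1+6t%6 t = trans (cong (λ z → suc z % 6) (ℕₚ.*-comm 6 t)) (ℕ÷.[m+kn]%n≡m%n 1 t 6)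

ℓ≡1+6⌊ℓ/6⌋ : ∀ ℓ → ℓ % 6 ≡ 1 → ℓ ≡ suc (⌊ℓ/6⌋ ℓ * 6)
ℓ≡1+6⌊ℓ/6⌋ ℓ ℓ%6≡1 = trans (ℕ÷.m≡m%n+[m/n]*n ℓ 6) (cong (_+ ⌊ℓ/6⌋ ℓ * 6) ℓ%6≡1)

pointCount-off : ∀ ℓ → ℓ % 6 ≢ 1 → ∀ n → pointCount n ℓ ≡ + 0
pointCount-off ℓ ℓ%6≢1 n = Σ₁-zero _ n (λ t _ _ →
  𝟙-cong (ℓ ℕ.≟ suc (6 * t)) (no (λ ())) (λ ℓ≡ → ℓ%6≢1 (trans (cong (_% 6) ℓ≡) (1+6t%6 t))) (λ ()))

-- When ℓ ≡ 1 (mod 6) the only candidate is t = ⌊ℓ/6⌋.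
pointCount-on : ∀ ℓ → ℓ % 6 ≡ 1 → ∀ n → pointCount n ℓ ≡ count (pred (⌊ℓ/6⌋ ℓ)) (⌊ℓ/6⌋ ℓ) n
pointCount-on ℓ ℓ%6≡1 n = Σ₁-cong n (λ t 1≤t _ → 𝟙-cong (ℓ ℕ.≟ suc (6 * t)) (between? (pred (⌊ℓ/6⌋ ℓ)) (⌊ℓ/6⌋ ℓ) t) (to t 1≤t) (from t 1≤t))
  where
  to : ∀ t → 1 ≤ t → ℓ ≡ suc (6 * t) → pred (⌊ℓ/6⌋ ℓ) < t × t ≤ ⌊ℓ/6⌋ ℓ
  to (suc t) _ ℓ≡ = subst (λ q → pred q < suc t × suc t ≤ q) (sym q≡t) (ℕₚ.≤-refl , ℕₚ.≤-refl)
    where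
    q≡t : ⌊ℓ/6⌋ ℓ ≡ suc t
    q≡t = ℕₚ.*-cancelʳ-≡ (⌊ℓ/6⌋ ℓ) (suc t) 6 (ℕₚ.suc-injective (trans (sym (ℓ≡1+6⌊ℓ/6⌋ ℓ ℓ%6≡1)) (trans ℓ≡ (cong suc (ℕₚ.*-comm 6 (suc t))))))
  from : ∀ t → 1 ≤ t → pred (⌊ℓ/6⌋ ℓ) < t × t ≤ ⌊ℓ/6⌋ ℓ → ℓ ≡ suc (6 * t)
  from t 1≤t (lo , hi) = trans (ℓ≡1+6⌊ℓ/6⌋ ℓ ℓ%6≡1) (cong suc (trans (cong (_* 6) (sym t≡q)) (ℕₚ.*-comm t 6)))
    where
    squeeze : ∀ q → pred q < t → t ≤ q → t ≡ q
    squeeze zero    _  t≤0 = ⊥-elim (ℕₚ.<-irrefl refl (ℕₚ.≤-trans 1≤t t≤0))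
    squeeze (suc q) lo hi = ℕₚ.≤-antisym hi lo
    t≡q : t ≡ ⌊ℓ/6⌋ ℓ
    t≡q = squeeze (⌊ℓ/6⌋ ℓ) lo hi

prodCoeff-counts : ∀ n ℓ → prodCoeff n ℓ ≡
  count (⌊ℓ/6⌋ ℓ) (⌊ℓ/4⌋ ℓ) n ℤ.+ pointCount n ℓ ℤ.- count (⌊ℓ-2/4⌋ ℓ) (⌊ℓ-1/3⌋ ℓ) n
prodCoeff-counts n ℓ =
  trans (Σ<-- _ _ n)
        (cong₂ ℤ._-_ (trans (Σ<-+ _ _ n) (cong (ℤ._+ pointCount n ℓ) (Σ₁-cong n (λ t _ _ → upper-window-count ℓ t))))
                     (Σ₁-cong n (λ t 1≤t _ → lower-window-count ℓ t 1≤t)))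

δℕ : ℕ → ℕ
δℕ ℓ = if ℓ % 6 ℕ.≡ᵇ 1 then 1 else 0

δ≡δℕ : ∀ ℓ → δ ℓ ≡ + δℕ ℓ
δ≡δℕ ℓ with ℓ % 6 ℕ.≡ᵇ 1
... | true  = refl
... | false = refl

δℕ-on : ∀ ℓ → ℓ % 6 ≡ 1 → δℕ ℓ ≡ 1
δℕ-on ℓ ℓ%6≡1 = cong (λ z → if z ℕ.≡ᵇ 1 then 1 else 0) ℓ%6≡1

δℕ-off : ∀ ℓ → ℓ % 6 ≢ 1 → δℕ ℓ ≡ 0
δℕ-off ℓ ℓ%6≢1 with ℓ % 6 ℕ.≡ᵇ 1 in eq
... | false = refl
... | true  = ⊥-elim (ℓ%6≢1 (ℕₚ.≡ᵇ⇒≡ (ℓ % 6) 1 (subst T (sym eq) tt)))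

record FloorFacts (ℓ : ℕ) : Set where
  constructor floorFacts
  field
    a₂≤a₁   : ⌊ℓ/6⌋ ℓ ≤ ⌊ℓ-2/4⌋ ℓ
    a₁≤b₂   : ⌊ℓ-2/4⌋ ℓ ≤ ⌊ℓ/4⌋ ℓ
    b₂≤b₁   : ⌊ℓ/4⌋ ℓ ≤ ⌊ℓ-1/3⌋ ℓ
    balance : ⌊ℓ/4⌋ ℓ + δℕ ℓ + ⌊ℓ-2/4⌋ ℓ ≡ ⌊ℓ-1/3⌋ ℓ + ⌊ℓ/6⌋ ℓ
    a₂-pos  : ℓ % 6 ≡ 1 → 1 ≤ ⌊ℓ/6⌋ ℓ

byEval : ∀ {m n} → T (m ≤ᵇ n) → m ≤ n
byEval = ℕₚ.≤ᵇ⇒≤ _ _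

floorFacts-base : ∀ r → r < 12 → FloorFacts (2 + r)
floorFacts-base 0  _ = floorFacts (byEval tt) (byEval tt) (byEval tt) refl (λ ())
floorFacts-base 1  _ = floorFacts (byEval tt) (byEval tt) (byEval tt) refl (λ ())
floorFacts-base 2  _ = floorFacts (byEval tt) (byEval tt) (byEval tt) refl (λ ())
floorFacts-base 3  _ = floorFacts (byEval tt) (byEval tt) (byEval tt) refl (λ ())
floorFacts-base 4  _ = floorFacts (byEval tt) (byEval tt) (byEval tt) refl (λ ())
floorFacts-base 5  _ = floorFacts (byEval tt) (byEval tt) (byEval tt) refl (λ _ → byEval tt)
floorFacts-base 6  _ = floorFacts (byEval tt) (byEval tt) (byEval tt) refl (λ ())
floorFacts-base 7  _ = floorFacts (byEval tt) (byEval tt) (byEval tt) refl (λ ())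
floorFacts-base 8  _ = floorFacts (byEval tt) (byEval tt) (byEval tt) refl (λ ())
floorFacts-base 9  _ = floorFacts (byEval tt) (byEval tt) (byEval tt) refl (λ ())
floorFacts-base 10 _ = floorFacts (byEval tt) (byEval tt) (byEval tt) refl (λ ())
floorFacts-base 11 _ = floorFacts (byEval tt) (byEval tt) (byEval tt) refl (λ _ → byEval tt)
floorFacts-base (suc (suc (suc (suc (suc (suc (suc (suc (suc (suc (suc (suc r)))))))))))) (s≤s (s≤s (s≤s (s≤s (s≤s (s≤s (s≤s (s≤s (s≤s (s≤s (s≤s (s≤s ()))))))))))))

-- Shifting ℓ by 12 shifts each floor by a multiple of q and keeps ℓ mod 6.
/-shift : ∀ c q d m .{{_ : NonZero d}} → 12 * q ≡ (m * q) * d → (c + 12 * q) / d ≡ c / d + m * q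
/-shift c q d m eq = trans (ℕ÷.+-distrib-/-∣ʳ c (ℕ∣.divides (m * q) eq)) (cong (λ z → c / d + z) (trans (cong (_/ d) eq) (ℕ÷.m*n/n≡m (m * q) d)))

%6-shift : ∀ c q → (c + 12 * q) % 6 ≡ c % 6
%6-shift c q = trans (cong (λ z → (c + z) % 6) (eq q)) (ℕ÷.[m+kn]%n≡m%n c (2 * q) 6)
  where eq : ∀ q → 12 * q ≡ 2 * q * 6
        eq = solve-∀

floorFacts-periodic : ∀ r q → FloorFacts (2 + r) → FloorFacts (2 + r + 12 * q)
floorFacts-periodic r q ff = floorFacts
  (subst₂ _≤_ (sym a₂) (sym a₁) (ℕₚ.+-mono-≤ (FloorFacts.a₂≤a₁ ff) (ℕₚ.*-monoˡ-≤ q (byEval {2} {3} tt))))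
  (subst₂ _≤_ (sym a₁) (sym b₂) (ℕₚ.+-monoˡ-≤ (3 * q) (FloorFacts.a₁≤b₂ ff)))
  (subst₂ _≤_ (sym b₂) (sym b₁) (ℕₚ.+-mono-≤ (FloorFacts.b₂≤b₁ ff) (ℕₚ.*-monoˡ-≤ q (byEval {3} {4} tt))))
  balance
  (λ ℓ%6≡1 → subst (1 ≤_) (sym a₂) (ℕₚ.≤-trans (FloorFacts.a₂-pos ff (trans (sym (%6-shift (2 + r) q)) ℓ%6≡1)) (ℕₚ.m≤m+n _ (2 * q))))
  where
  ℓ = 2 + r + 12 * q
  a₂ : ⌊ℓ/6⌋ ℓ ≡ ⌊ℓ/6⌋ (2 + r) + 2 * q
  a₂ = /-shift (2 + r) q 6 2 (eq q)
    where eq : ∀ q → 12 * q ≡ 2 * q * 6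
          eq = solve-∀
  b₂ : ⌊ℓ/4⌋ ℓ ≡ ⌊ℓ/4⌋ (2 + r) + 3 * q
  b₂ = /-shift (2 + r) q 4 3 (eq q)
    where eq : ∀ q → 12 * q ≡ 3 * q * 4
          eq = solve-∀
  a₁ : ⌊ℓ-2/4⌋ ℓ ≡ ⌊ℓ-2/4⌋ (2 + r) + 3 * q
  a₁ = /-shift r q 4 3 (eq q)
    where eq : ∀ q → 12 * q ≡ 3 * q * 4
          eq = solve-∀
  b₁ : ⌊ℓ-1/3⌋ ℓ ≡ ⌊ℓ-1/3⌋ (2 + r) + 4 * q
  b₁ = /-shift (1 + r) q 3 4 (eq q)
    where eq : ∀ q → 12 * q ≡ 4 * q * 3
          eq = solve-∀
  balance : ⌊ℓ/4⌋ ℓ + δℕ ℓ + ⌊ℓ-2/4⌋ ℓ ≡ ⌊ℓ-1/3⌋ ℓ + ⌊ℓ/6⌋ ℓ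
  balance = begin
    ⌊ℓ/4⌋ ℓ + δℕ ℓ + ⌊ℓ-2/4⌋ ℓ                       ≡⟨ cong₂ (λ u v → u + v + ⌊ℓ-2/4⌋ ℓ) b₂ (cong (λ z → if z ℕ.≡ᵇ 1 then 1 else 0) (%6-shift (2 + r) q)) ⟩
    (y₂ + 3 * q) + δℕ (2 + r) + ⌊ℓ-2/4⌋ ℓ            ≡⟨ cong (λ z → (y₂ + 3 * q) + δℕ (2 + r) + z) a₁ ⟩
    (y₂ + 3 * q) + δℕ (2 + r) + (x₁ + 3 * q)         ≡⟨ collect y₂ (δℕ (2 + r)) x₁ q ⟩
    (y₂ + δℕ (2 + r) + x₁) + 6 * q                   ≡⟨ cong (_+ 6 * q) (FloorFacts.balance ff) ⟩
    (y₁ + x₂) + 6 * q                                ≡⟨ spread y₁ x₂ q ⟩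
    (y₁ + 4 * q) + (x₂ + 2 * q)                      ≡⟨ sym (cong₂ _+_ b₁ a₂) ⟩
    ⌊ℓ-1/3⌋ ℓ + ⌊ℓ/6⌋ ℓ                              ∎
    where
    open ≡-Reasoning
    x₂ = ⌊ℓ/6⌋ (2 + r)
    y₂ = ⌊ℓ/4⌋ (2 + r)
    x₁ = ⌊ℓ-2/4⌋ (2 + r)
    y₁ = ⌊ℓ-1/3⌋ (2 + r)
    collect : ∀ a b c q → (a + 3 * q) + b + (c + 3 * q) ≡ (a + b + c) + 6 * q
    collect = solve-∀
    spread : ∀ a b q → (a + b) + 6 * q ≡ (a + 4 * q) + (b + 2 * q)
    spread = solve-∀

floor-facts : ∀ ℓ → 2 ≤ ℓ → FloorFacts ℓ
floor-facts ℓ 2≤ℓ = subst FloorFacts (sym ℓ≡) (floorFacts-periodic r q (floorFacts-base r (ℕ÷.m%n<n (ℓ ∸ 2) 12)))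
  where
  r = (ℓ ∸ 2) % 12
  q = (ℓ ∸ 2) / 12
  ℓ≡ : ℓ ≡ 2 + r + 12 * q
  ℓ≡ = trans (sym (ℕₚ.m+[n∸m]≡n 2≤ℓ))
             (cong (λ z → 2 + z) (trans (ℕ÷.m≡m%n+[m/n]*n (ℓ ∸ 2) 12) (cong (λ z → r + z) (ℕₚ.*-comm q 12))))

pointCount-value : ∀ n ℓ → 2 ≤ ℓ → ⌊ℓ/6⌋ ℓ ≤ n → pointCount n ℓ ≡ + δℕ ℓ
pointCount-value n ℓ 2≤ℓ a₂≤n with ℓ % 6 ℕ.≟ 1
... | no ℓ%6≢1  = trans (pointCount-off ℓ ℓ%6≢1 n) (cong +_ (sym (δℕ-off ℓ ℓ%6≢1)))
... | yes ℓ%6≡1 = begin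
  pointCount n ℓ                                    ≡⟨ pointCount-on ℓ ℓ%6≡1 n ⟩
  count (pred (⌊ℓ/6⌋ ℓ)) (⌊ℓ/6⌋ ℓ) n                ≡⟨ count-closed _ _ n ℕₚ.pred[n]≤n ⟩
  + (n ⊓ ⌊ℓ/6⌋ ℓ) ℤ.- + (n ⊓ pred (⌊ℓ/6⌋ ℓ))        ≡⟨ unit (⌊ℓ/6⌋ ℓ) (FloorFacts.a₂-pos (floor-facts ℓ 2≤ℓ) ℓ%6≡1) a₂≤n ⟩
  + 1                                               ≡⟨ cong +_ (sym (δℕ-on ℓ ℓ%6≡1)) ⟩
  + δℕ ℓ                                            ∎
  where
  open ≡-Reasoning
  unit : ∀ a → 1 ≤ a → a ≤ n → + (n ⊓ a) ℤ.- + (n ⊓ pred a) ≡ + 1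
  unit (suc a) _ a<n = begin
    + (n ⊓ suc a) ℤ.- + (n ⊓ a)   ≡⟨ cong₂ (λ u v → + u ℤ.- + v) (ℕₚ.m≥n⇒m⊓n≡n a<n) (ℕₚ.m≥n⇒m⊓n≡n (ℕₚ.<⇒≤ a<n)) ⟩
    + suc a ℤ.- + a               ≡⟨ cong (ℤ._- + a) (ℤₚ.pos-+ 1 a) ⟩
    + 1 ℤ.+ + a ℤ.- + a           ≡⟨ cancel (+ a) ⟩
    + 1                           ∎
    where cancel : ∀ y → + 1 ℤ.+ y ℤ.- y ≡ + 1
          cancel = ℤSolver.solve-∀

module _ (n ℓ : ℕ) (2≤ℓ : 2 ≤ ℓ) where
  private
    open FloorFacts (floor-facts ℓ 2≤ℓ)
    a₂ = ⌊ℓ/6⌋ ℓ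
    b₂ = ⌊ℓ/4⌋ ℓ
    a₁ = ⌊ℓ-2/4⌋ ℓ
    b₁ = ⌊ℓ-1/3⌋ ℓ
    counts = prodCoeff-counts n ℓ
    upper = count-closed a₂ b₂ n (ℕₚ.≤-trans a₂≤a₁ a₁≤b₂)
    lower = count-closed a₁ b₁ n (ℕₚ.≤-trans a₁≤b₂ b₂≤b₁)

  -- For n ≤ ⌊ℓ/4⌋ the upper bounds of both counts are inactive.
  prodCoeff-small-n : n ≤ b₂ → prodCoeff n ℓ ≡ + (n ⊓ a₁) ℤ.- + (n ⊓ a₂) ℤ.+ pointCount n ℓ
  prodCoeff-small-n n≤b₂ = begin
    prodCoeff n ℓ
      ≡⟨ counts ⟩
    count a₂ b₂ n ℤ.+ pointCount n ℓ ℤ.- count a₁ b₁ n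
      ≡⟨ cong₂ (λ u v → u ℤ.+ pointCount n ℓ ℤ.- v) upper lower ⟩
    + (n ⊓ b₂) ℤ.- + (n ⊓ a₂) ℤ.+ pointCount n ℓ ℤ.- (+ (n ⊓ b₁) ℤ.- + (n ⊓ a₁))
      ≡⟨ cong₂ (λ u v → + u ℤ.- + (n ⊓ a₂) ℤ.+ pointCount n ℓ ℤ.- (+ v ℤ.- + (n ⊓ a₁))) (ℕₚ.m≤n⇒m⊓n≡m n≤b₂) (ℕₚ.m≤n⇒m⊓n≡m (ℕₚ.≤-trans n≤b₂ b₂≤b₁)) ⟩
    + n ℤ.- + (n ⊓ a₂) ℤ.+ pointCount n ℓ ℤ.- (+ n ℤ.- + (n ⊓ a₁))
      ≡⟨ simplify (+ n) (+ (n ⊓ a₂)) (pointCount n ℓ) (+ (n ⊓ a₁)) ⟩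
    + (n ⊓ a₁) ℤ.- + (n ⊓ a₂) ℤ.+ pointCount n ℓ
      ∎
    where
    open ≡-Reasoning
    simplify : ∀ a b c d → a ℤ.- b ℤ.+ c ℤ.- (a ℤ.- d) ≡ d ℤ.- b ℤ.+ c
    simplify = ℤSolver.solve-∀

  -- For n ≥ ⌊ℓ/4⌋ the upper count is complete, and the balance relation applies.
  prodCoeff-large-n : b₂ ≤ n → prodCoeff n ℓ ≡ + b₁ ℤ.- + (n ⊓ b₁)
  prodCoeff-large-n b₂≤n = begin
    prodCoeff n ℓ
      ≡⟨ counts ⟩
    count a₂ b₂ n ℤ.+ pointCount n ℓ ℤ.- count a₁ b₁ n
      ≡⟨ cong₂ (λ u v → u ℤ.+ pointCount n ℓ ℤ.- v) upper lower ⟩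
    + (n ⊓ b₂) ℤ.- + (n ⊓ a₂) ℤ.+ pointCount n ℓ ℤ.- (+ (n ⊓ b₁) ℤ.- + (n ⊓ a₁))
      ≡⟨ cong₂ (λ u v → + u ℤ.- + v ℤ.+ pointCount n ℓ ℤ.- (+ (n ⊓ b₁) ℤ.- + (n ⊓ a₁))) (ℕₚ.m≥n⇒m⊓n≡n b₂≤n) (ℕₚ.m≥n⇒m⊓n≡n a₂≤n) ⟩
    + b₂ ℤ.- + a₂ ℤ.+ pointCount n ℓ ℤ.- (+ (n ⊓ b₁) ℤ.- + (n ⊓ a₁))
      ≡⟨ cong₂ (λ u v → + b₂ ℤ.- + a₂ ℤ.+ u ℤ.- (+ (n ⊓ b₁) ℤ.- + v)) (pointCount-value n ℓ 2≤ℓ a₂≤n) (ℕₚ.m≥n⇒m⊓n≡n (ℕₚ.≤-trans a₁≤b₂ b₂≤n)) ⟩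
    + b₂ ℤ.- + a₂ ℤ.+ + δℕ ℓ ℤ.- (+ (n ⊓ b₁) ℤ.- + a₁)
      ≡⟨ regroup (+ b₂) (+ a₂) (+ δℕ ℓ) (+ (n ⊓ b₁)) (+ a₁) ⟩
    + b₂ ℤ.+ + δℕ ℓ ℤ.+ + a₁ ℤ.- + a₂ ℤ.- + (n ⊓ b₁)
      ≡⟨ cong (λ z → z ℤ.- + a₂ ℤ.- + (n ⊓ b₁)) balanceℤ ⟩
    + b₁ ℤ.+ + a₂ ℤ.- + a₂ ℤ.- + (n ⊓ b₁)
      ≡⟨ cancel (+ b₁) (+ a₂) (+ (n ⊓ b₁)) ⟩
    + b₁ ℤ.- + (n ⊓ b₁)
      ∎
    where
    open ≡-Reasoning
    a₂≤n = ℕₚ.≤-trans (ℕₚ.≤-trans a₂≤a₁ a₁≤b₂) b₂≤n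
    regroup : ∀ a b c d e → a ℤ.- b ℤ.+ c ℤ.- (d ℤ.- e) ≡ a ℤ.+ c ℤ.+ e ℤ.- b ℤ.- d
    regroup = ℤSolver.solve-∀
    cancel : ∀ a b c → a ℤ.+ b ℤ.- b ℤ.- c ≡ a ℤ.- c
    cancel = ℤSolver.solve-∀
    balanceℤ : + b₂ ℤ.+ + δℕ ℓ ℤ.+ + a₁ ≡ + b₁ ℤ.+ + a₂
    balanceℤ = trans (sym (trans (ℤₚ.pos-+ (b₂ + δℕ ℓ) a₁) (cong (ℤ._+ + a₁) (ℤₚ.pos-+ b₂ (δℕ ℓ)))))
                     (trans (cong +_ balance) (ℤₚ.pos-+ b₁ a₂))

private
  ∸-nonneg : ∀ {x y} → y ≤ x → + 0 ℤ.≤ + x ℤ.- + y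
  ∸-nonneg {x} {y} y≤x = subst (+ 0 ℤ.≤_) (sym (trans (ℤₚ.m-n≡m⊖n x y) (ℤₚ.⊖-≥ y≤x))) (ℤ.+≤+ z≤n)

  self-diff : ∀ x → + x ℤ.- + x ≡ + 0
  self-diff x = ℤₚ.+-inverseʳ (+ x)

prodCoeff-tiny : ∀ n ℓ → ℓ < 2 → prodCoeff n ℓ ≡ + 0
prodCoeff-tiny n ℓ ℓ<2 = Σ₁-zero _ n (λ t 1≤t _ → vanish
  (𝟙-cong (range? (4 * t) (4 * t + 2 * t) ℓ) (no (λ ())) (λ (lo , _) → below (ℕₚ.*-mono-≤ (byEval {2} {4} tt) 1≤t) lo) (λ ()))
  (𝟙-cong (ℓ ℕ.≟ suc (6 * t)) (no (λ ())) (λ ℓ≡ → below (s≤s (ℕₚ.*-mono-≤ (byEval {1} {6} tt) 1≤t)) (ℕₚ.≤-reflexive (sym ℓ≡))) (λ ()))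
  (𝟙-cong (range? (suc (3 * t)) (suc (3 * t) + suc t) ℓ) (no (λ ())) (λ (lo , _) → below (s≤s (ℕₚ.*-mono-≤ (byEval {1} {3} tt) 1≤t)) lo) (λ ())))
  where
  below : ∀ {x} → 2 ≤ x → x ≤ ℓ → ⊥
  below 2≤x x≤ℓ = ℕₚ.<-irrefl refl (ℕₚ.<-≤-trans ℓ<2 (ℕₚ.≤-trans 2≤x x≤ℓ))
  vanish : ∀ {a b c} → a ≡ + 0 → b ≡ + 0 → c ≡ + 0 → a ℤ.+ b ℤ.- c ≡ + 0
  vanish refl refl refl = refl

prodCoeff-nonneg : ∀ n ℓ → + 0 ℤ.≤ prodCoeff n ℓ
prodCoeff-nonneg n ℓ with ℕₚ.<-≤-connex ℓ 2
... | inj₁ ℓ<2 = ℤₚ.≤-reflexive (sym (prodCoeff-tiny n ℓ ℓ<2))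
... | inj₂ 2≤ℓ with ℕₚ.≤-<-connex n (⌊ℓ/4⌋ ℓ)
...   | inj₁ n≤b₂ = subst (+ 0 ℤ.≤_) (sym (prodCoeff-small-n n ℓ 2≤ℓ n≤b₂))
                      (ℤₚ.+-mono-≤ (∸-nonneg (ℕₚ.⊓-monoʳ-≤ n (FloorFacts.a₂≤a₁ (floor-facts ℓ 2≤ℓ))))
                                   (Σ₁-nonneg _ n (λ t → 𝟙-nonneg (ℓ ℕ.≟ suc (6 * t)))))
...   | inj₂ b₂<n = subst (+ 0 ℤ.≤_) (sym (prodCoeff-large-n n ℓ 2≤ℓ (ℕₚ.<⇒≤ b₂<n))) (∸-nonneg (ℕₚ.m⊓n≤n n (⌊ℓ-1/3⌋ ℓ)))

prodCoeff-low : ∀ n ℓ → ℓ ≤ 3 * n + 3 → prodCoeff n ℓ ≡ + 0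
prodCoeff-low n ℓ ℓ≤ with ℕₚ.<-≤-connex ℓ 2
... | inj₁ ℓ<2 = prodCoeff-tiny n ℓ ℓ<2
... | inj₂ 2≤ℓ = begin
  prodCoeff n ℓ                        ≡⟨ prodCoeff-large-n n ℓ 2≤ℓ (ℕₚ.≤-trans (FloorFacts.b₂≤b₁ (floor-facts ℓ 2≤ℓ)) b₁≤n) ⟩
  + ⌊ℓ-1/3⌋ ℓ ℤ.- + (n ⊓ ⌊ℓ-1/3⌋ ℓ)    ≡⟨ cong (λ z → + ⌊ℓ-1/3⌋ ℓ ℤ.- + z) (ℕₚ.m≥n⇒m⊓n≡n b₁≤n) ⟩
  + ⌊ℓ-1/3⌋ ℓ ℤ.- + ⌊ℓ-1/3⌋ ℓ          ≡⟨ self-diff (⌊ℓ-1/3⌋ ℓ) ⟩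
  + 0                                  ∎
  where
  open ≡-Reasoning
  ℓ≤′ : ℓ ≤ 3 + n * 3
  ℓ≤′ = subst (ℓ ≤_) (eq n) ℓ≤
    where eq : ∀ n → 3 * n + 3 ≡ 3 + n * 3
          eq = solve-∀
  b₁≤n : ⌊ℓ-1/3⌋ ℓ ≤ n
  b₁≤n = ℕₚ.≤-pred (<*⇒/< (suc n) (ℓ ∸ 1) 3 (s≤s (ℕₚ.∸-monoˡ-≤ 1 ℓ≤′)))

prodCoeff-high : ∀ n ℓ → 6 * n + 2 ≤ ℓ → prodCoeff n ℓ ≡ + 0
prodCoeff-high n ℓ ℓ≥ = begin
  prodCoeff n ℓ                                          ≡⟨ prodCoeff-small-n n ℓ 2≤ℓ n≤b₂ ⟩
  + (n ⊓ ⌊ℓ-2/4⌋ ℓ) ℤ.- + (n ⊓ ⌊ℓ/6⌋ ℓ) ℤ.+ pointCount n ℓ ≡⟨ cong₂ (λ u v → + u ℤ.- + v ℤ.+ pointCount n ℓ) (ℕₚ.m≤n⇒m⊓n≡m (ℕₚ.≤-trans n≤a₂ (FloorFacts.a₂≤a₁ (floor-facts ℓ 2≤ℓ)))) (ℕₚ.m≤n⇒m⊓n≡m n≤a₂) ⟩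
  + n ℤ.- + n ℤ.+ pointCount n ℓ                         ≡⟨ cong₂ ℤ._+_ (self-diff n) no-point ⟩
  + 0                                                    ∎
  where
  open ≡-Reasoning
  6n≤ℓ : n * 6 ≤ ℓ
  6n≤ℓ = ℕₚ.≤-trans (≤-of-sum (n * 6) 2 (eq n)) ℓ≥
    where eq : ∀ n → 6 * n + 2 ≡ n * 6 + 2
          eq = solve-∀
  2≤ℓ : 2 ≤ ℓ
  2≤ℓ = ℕₚ.≤-trans (ℕₚ.m≤n+m 2 (6 * n)) ℓ≥
  n≤a₂ : n ≤ ⌊ℓ/6⌋ ℓ
  n≤a₂ = *≤⇒≤/ n ℓ 6 6n≤ℓ
  n≤b₂ : n ≤ ⌊ℓ/4⌋ ℓ
  n≤b₂ = *≤⇒≤/ n ℓ 4 (ℕₚ.≤-trans (ℕₚ.*-monoʳ-≤ n (byEval {4} {6} tt)) 6n≤ℓ)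
  -- the point 6t + 1 = ℓ would need t = ⌊ℓ/6⌋ > n
  no-point : pointCount n ℓ ≡ + 0
  no-point with ℓ % 6 ℕ.≟ 1
  ... | no ℓ%6≢1  = pointCount-off ℓ ℓ%6≢1 n
  ... | yes ℓ%6≡1 = begin
    pointCount n ℓ                                   ≡⟨ pointCount-on ℓ ℓ%6≡1 n ⟩
    count (pred (⌊ℓ/6⌋ ℓ)) (⌊ℓ/6⌋ ℓ) n               ≡⟨ count-closed _ _ n ℕₚ.pred[n]≤n ⟩
    + (n ⊓ ⌊ℓ/6⌋ ℓ) ℤ.- + (n ⊓ pred (⌊ℓ/6⌋ ℓ))       ≡⟨ cong₂ (λ u v → + u ℤ.- + v) (ℕₚ.m≤n⇒m⊓n≡m (ℕₚ.≤-trans n≤pred ℕₚ.pred[n]≤n)) (ℕₚ.m≤n⇒m⊓n≡m n≤pred) ⟩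
    + n ℤ.- + n                                      ≡⟨ self-diff n ⟩
    + 0                                              ∎
    where
    6n+2≤ : 6 * n + 2 ≤ suc (⌊ℓ/6⌋ ℓ * 6)
    6n+2≤ = subst (6 * n + 2 ≤_) (ℓ≡1+6⌊ℓ/6⌋ ℓ ℓ%6≡1) ℓ≥
    n<a₂ : n * 6 < ⌊ℓ/6⌋ ℓ * 6
    n<a₂ = ℕₚ.≤-pred (subst (_≤ suc (⌊ℓ/6⌋ ℓ * 6)) (eq n) 6n+2≤)
      where eq : ∀ n → 6 * n + 2 ≡ suc (suc (n * 6))
            eq = solve-∀
    n≤pred : n ≤ pred (⌊ℓ/6⌋ ℓ)
    n≤pred = ℕₚ.<⇒≤pred (ℕₚ.*-cancelʳ-< 6 n (⌊ℓ/6⌋ ℓ) n<a₂)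

private
  if-true : ∀ {b} {x y : ℤ} → T b → (if b then x else y) ≡ x
  if-true {true} _ = refl

  if-false : ∀ {b} {x y : ℤ} → ¬ T b → (if b then x else y) ≡ y
  if-false {false} _  = refl
  if-false {true}  ¬t = ⊥-elim (¬t tt)

e-range₁ : ∀ n ℓ → ℓ < 4 * n → e n ℓ ≡ + ⌊ℓ-1/3⌋ ℓ ℤ.- + n
e-range₁ n ℓ ℓ<4n = if-true (ℕₚ.<⇒<ᵇ ℓ<4n)

e-range₂ : ∀ n ℓ → ¬ (ℓ < 4 * n) → ℓ ≤ 4 * n + 1 → e n ℓ ≡ δ ℓ ℤ.+ + n ℤ.- + 1 ℤ.- + ⌊ℓ/6⌋ ℓ
e-range₂ n ℓ ℓ≮4n ℓ≤ = trans (if-false (λ t → ℓ≮4n (ℕₚ.<ᵇ⇒< ℓ (4 * n) t))) (if-true (ℕₚ.≤⇒≤ᵇ ℓ≤))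

e-range₃ : ∀ n ℓ → ¬ (ℓ ≤ 4 * n + 1) → ℓ ≤ 6 * n → e n ℓ ≡ δ ℓ ℤ.+ + n ℤ.- + ⌊ℓ/6⌋ ℓ
e-range₃ n ℓ ℓ≰ ℓ≤ = trans (if-false (λ t → ℓ≰ (ℕₚ.≤-trans (ℕₚ.<⇒≤ (ℕₚ.<ᵇ⇒< ℓ (4 * n) t)) (ℕₚ.m≤m+n (4 * n) 1))))
                       (trans (if-false (λ t → ℓ≰ (ℕₚ.≤ᵇ⇒≤ ℓ (4 * n + 1) t))) (if-true (ℕₚ.≤⇒≤ᵇ ℓ≤)))

e-range₄ : ∀ n ℓ → ¬ (ℓ ≤ 4 * n + 1) → ¬ (ℓ ≤ 6 * n) → e n ℓ ≡ + 1
e-range₄ n ℓ ℓ≰4n+1 ℓ≰6n = trans (if-false (λ t → ℓ≰4n+1 (ℕₚ.≤-trans (ℕₚ.<⇒≤ (ℕₚ.<ᵇ⇒< ℓ (4 * n) t)) (ℕₚ.m≤m+n (4 * n) 1))))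
                             (trans (if-false (λ t → ℓ≰4n+1 (ℕₚ.≤ᵇ⇒≤ ℓ (4 * n + 1) t))) (if-false (λ t → ℓ≰6n (ℕₚ.≤ᵇ⇒≤ ℓ (6 * n) t))))

-- On the range 3n + 4 ≤ ℓ ≤ 6n + 1 the coefficient is exactly e_{n,ℓ}; the
-- four cases of the definition of e correspond to the position of n among
-- the floors ⌊ℓ/6⌋ ≤ ⌊(ℓ−2)/4⌋ ≤ ⌊ℓ/4⌋ ≤ ⌊(ℓ−1)/3⌋.
module _ (n′ ℓ : ℕ) (ℓ≥ : 3 * suc n′ + 4 ≤ ℓ) where
  private
    n = suc n′
    2≤ℓ : 2 ≤ ℓ
    2≤ℓ = ℕₚ.≤-trans (ℕₚ.m≤n+m 2 (3 * n + 2)) (ℕₚ.≤-trans (ℕₚ.≤-reflexive (eq n′)) ℓ≥)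
      where eq : ∀ n′ → 3 * suc n′ + 2 + 2 ≡ 3 * suc n′ + 4
            eq = solve-∀
    open FloorFacts (floor-facts ℓ 2≤ℓ)
    a₂ = ⌊ℓ/6⌋ ℓ
    a₁ = ⌊ℓ-2/4⌋ ℓ
    b₁ = ⌊ℓ-1/3⌋ ℓ
    small-n-value : ∀ {m} → n ≤ ⌊ℓ/4⌋ ℓ → a₂ ≤ n → n ⊓ a₁ ≡ m → prodCoeff n ℓ ≡ + m ℤ.- + a₂ ℤ.+ δ ℓ
    small-n-value {m} n≤b₂ a₂≤n n⊓a₁ = begin
      prodCoeff n ℓ                                    ≡⟨ prodCoeff-small-n n ℓ 2≤ℓ n≤b₂ ⟩
      + (n ⊓ a₁) ℤ.- + (n ⊓ a₂) ℤ.+ pointCount n ℓ     ≡⟨ cong₂ (λ u v → + u ℤ.- + v ℤ.+ pointCount n ℓ) n⊓a₁ (ℕₚ.m≥n⇒m⊓n≡n a₂≤n) ⟩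
      + m ℤ.- + a₂ ℤ.+ pointCount n ℓ                  ≡⟨ cong (λ z → + m ℤ.- + a₂ ℤ.+ z) (trans (pointCount-value n ℓ 2≤ℓ a₂≤n) (sym (δ≡δℕ ℓ))) ⟩
      + m ℤ.- + a₂ ℤ.+ δ ℓ                             ∎
      where open ≡-Reasoning
    rotate : ∀ x y d → x ℤ.- y ℤ.+ d ≡ d ℤ.+ x ℤ.- y
    rotate = ℤSolver.solve-∀

  -- 3n + 4 ≤ ℓ < 4n: only the lower windows of large t are incomplete.
  prodCoeff-range₁ : ℓ < 4 * n → prodCoeff n ℓ ≡ e n ℓ
  prodCoeff-range₁ ℓ<4n = begin
    prodCoeff n ℓ             ≡⟨ prodCoeff-large-n n ℓ 2≤ℓ b₂≤n ⟩
    + b₁ ℤ.- + (n ⊓ b₁)       ≡⟨ cong (λ z → + b₁ ℤ.- + z) (ℕₚ.m≤n⇒m⊓n≡m n≤b₁) ⟩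
    + b₁ ℤ.- + n              ≡⟨ sym (e-range₁ n ℓ ℓ<4n) ⟩
    e n ℓ                     ∎
    where
    open ≡-Reasoning
    b₂≤n : ⌊ℓ/4⌋ ℓ ≤ n
    b₂≤n = ℕₚ.<⇒≤ (<*⇒/< n ℓ 4 (subst (ℓ <_) (ℕₚ.*-comm 4 n) ℓ<4n))
    ℓ≥′ : 4 + n * 3 ≤ ℓ
    ℓ≥′ = subst (_≤ ℓ) (eq n′) ℓ≥
      where eq : ∀ n′ → 3 * suc n′ + 4 ≡ 4 + suc n′ * 3
            eq = solve-∀
    n≤b₁ : n ≤ b₁
    n≤b₁ = *≤⇒≤/ n (ℓ ∸ 1) 3 (ℕₚ.≤-trans (ℕₚ.m≤n+m (n * 3) 3) (ℕₚ.∸-monoˡ-≤ 1 ℓ≥′))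

  -- ℓ ∈ {4n, 4n + 1}: here ⌊(ℓ−2)/4⌋ = n − 1.
  prodCoeff-range₂ : ¬ (ℓ < 4 * n) → ℓ ≤ 4 * n + 1 → prodCoeff n ℓ ≡ e n ℓ
  prodCoeff-range₂ ℓ≮4n ℓ≤ = begin
    prodCoeff n ℓ                               ≡⟨ small-n-value n≤b₂ (ℕₚ.≤-trans (ℕₚ.≤-trans a₂≤a₁ a₁≤n′) (ℕₚ.n≤1+n n′)) n⊓a₁ ⟩
    + n′ ℤ.- + a₂ ℤ.+ δ ℓ                       ≡⟨ rearrange (+ n′) (+ a₂) (δ ℓ) ⟩
    δ ℓ ℤ.+ (+ 1 ℤ.+ + n′) ℤ.- + 1 ℤ.- + a₂     ≡⟨ cong (λ z → δ ℓ ℤ.+ z ℤ.- + 1 ℤ.- + a₂) (sym (ℤₚ.pos-+ 1 n′)) ⟩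
    δ ℓ ℤ.+ + n ℤ.- + 1 ℤ.- + a₂                ≡⟨ sym (e-range₂ n ℓ ℓ≮4n ℓ≤) ⟩
    e n ℓ                                       ∎
    where
    open ≡-Reasoning
    rearrange : ∀ x y d → x ℤ.- y ℤ.+ d ≡ d ℤ.+ (+ 1 ℤ.+ x) ℤ.- + 1 ℤ.- y
    rearrange = ℤSolver.solve-∀
    4n≤ℓ : n * 4 ≤ ℓ
    4n≤ℓ = subst (_≤ ℓ) (ℕₚ.*-comm 4 n) (ℕₚ.≮⇒≥ ℓ≮4n)
    n≤b₂ : n ≤ ⌊ℓ/4⌋ ℓ
    n≤b₂ = *≤⇒≤/ n ℓ 4 4n≤ℓ
    ℓ≤′ : ℓ ≤ 5 + n′ * 4
    ℓ≤′ = subst (ℓ ≤_) (eq n′) ℓ≤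
      where eq : ∀ n′ → 4 * suc n′ + 1 ≡ 5 + n′ * 4
            eq = solve-∀
    a₁≤n′ : a₁ ≤ n′
    a₁≤n′ = ℕₚ.≤-pred (<*⇒/< (suc n′) (ℓ ∸ 2) 4 (s≤s (ℕₚ.∸-monoˡ-≤ 2 ℓ≤′)))
    n′≤a₁ : n′ ≤ a₁
    n′≤a₁ = *≤⇒≤/ n′ (ℓ ∸ 2) 4 (ℕₚ.≤-trans (ℕₚ.m≤n+m (n′ * 4) 2) (ℕₚ.∸-monoˡ-≤ 2 4n≤ℓ))
    n⊓a₁ : n ⊓ a₁ ≡ n′
    n⊓a₁ = trans (ℕₚ.m≥n⇒m⊓n≡n (ℕₚ.≤-trans a₁≤n′ (ℕₚ.n≤1+n n′))) (ℕₚ.≤-antisym a₁≤n′ n′≤a₁)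

  -- 4n + 2 ≤ ℓ ≤ 6n: all upper and lower windows are complete.
  prodCoeff-range₃ : ¬ (ℓ ≤ 4 * n + 1) → ℓ ≤ 6 * n → prodCoeff n ℓ ≡ e n ℓ
  prodCoeff-range₃ ℓ≰ ℓ≤ = begin
    prodCoeff n ℓ             ≡⟨ small-n-value (ℕₚ.≤-trans n≤a₁ a₁≤b₂) a₂≤n (ℕₚ.m≤n⇒m⊓n≡m n≤a₁) ⟩
    + n ℤ.- + a₂ ℤ.+ δ ℓ      ≡⟨ rotate (+ n) (+ a₂) (δ ℓ) ⟩
    δ ℓ ℤ.+ + n ℤ.- + a₂      ≡⟨ sym (e-range₃ n ℓ ℓ≰ ℓ≤) ⟩
    e n ℓ                     ∎
    where
    open ≡-Reasoning
    4n+2≤ℓ : 2 + n * 4 ≤ ℓ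
    4n+2≤ℓ = subst (_≤ ℓ) (eq n′) (ℕₚ.≰⇒> ℓ≰)
      where eq : ∀ n′ → suc (4 * suc n′ + 1) ≡ 2 + suc n′ * 4
            eq = solve-∀
    n≤a₁ : n ≤ a₁
    n≤a₁ = *≤⇒≤/ n (ℓ ∸ 2) 4 (ℕₚ.∸-monoˡ-≤ 2 4n+2≤ℓ)
    a₂≤n : a₂ ≤ n
    a₂≤n = ℕₚ.≤-pred (<*⇒/< (suc n) ℓ 6 (s≤s (ℕₚ.≤-trans (subst (ℓ ≤_) (ℕₚ.*-comm 6 n) ℓ≤) (ℕₚ.m≤n+m (n * 6) 5))))

  -- ℓ = 6n + 1: the only contribution is the point 6t + 1 at t = n.
  prodCoeff-range₄ : ¬ (ℓ ≤ 4 * n + 1) → ¬ (ℓ ≤ 6 * n) → ℓ ≤ 6 * n + 1 → prodCoeff n ℓ ≡ e n ℓ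
  prodCoeff-range₄ ℓ≰4n+1 ℓ≰6n ℓ≤ = begin
    prodCoeff n ℓ             ≡⟨ small-n-value (ℕₚ.≤-trans n≤a₁ a₁≤b₂) (ℕₚ.≤-reflexive a₂≡n) (ℕₚ.m≤n⇒m⊓n≡m n≤a₁) ⟩
    + n ℤ.- + a₂ ℤ.+ δ ℓ      ≡⟨ cong₂ (λ u v → + n ℤ.- + u ℤ.+ v) a₂≡n (trans (δ≡δℕ ℓ) (cong +_ (δℕ-on ℓ ℓ%6≡1))) ⟩
    + n ℤ.- + n ℤ.+ + 1       ≡⟨ cong (ℤ._+ + 1) (ℤₚ.+-inverseʳ (+ n)) ⟩
    + 1                       ≡⟨ sym (e-range₄ n ℓ ℓ≰4n+1 ℓ≰6n) ⟩
    e n ℓ                     ∎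
    where
    open ≡-Reasoning
    ℓ≡ : ℓ ≡ suc (6 * n)
    ℓ≡ = ℕₚ.≤-antisym (subst (ℓ ≤_) (ℕₚ.+-comm (6 * n) 1) ℓ≤) (ℕₚ.≰⇒> ℓ≰6n)
    ℓ%6≡1 : ℓ % 6 ≡ 1
    ℓ%6≡1 = trans (cong (_% 6) ℓ≡) (1+6t%6 n)
    a₂≡n : a₂ ≡ n
    a₂≡n = ℕₚ.≤-antisym
      (ℕₚ.≤-pred (<*⇒/< (suc n) ℓ 6 (subst (_< suc n * 6) (sym ℓ≡) (s≤s (s≤s (ℕₚ.≤-trans (ℕₚ.≤-reflexive (ℕₚ.*-comm 6 n)) (ℕₚ.m≤n+m (n * 6) 4)))))))
      (*≤⇒≤/ n ℓ 6 (subst (n * 6 ≤_) (sym ℓ≡) (ℕₚ.≤-trans (ℕₚ.≤-reflexive (ℕₚ.*-comm n 6)) (ℕₚ.n≤1+n (6 * n)))))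
    n≤a₁ : n ≤ a₁
    n≤a₁ = *≤⇒≤/ n (ℓ ∸ 2) 4 (subst (λ z → n * 4 ≤ z ∸ 2) (sym ℓ≡) (≤-of-sum (n * 4) (2 * n′ + 1) (eq n′)))
      where eq : ∀ n′ → n′ + 5 * suc n′ ≡ suc n′ * 4 + (2 * n′ + 1)
            eq = solve-∀

prodCoeff≡e : ∀ n ℓ → 1 ≤ n → 3 * n + 4 ≤ ℓ → ℓ ≤ 6 * n + 1 → prodCoeff n ℓ ≡ e n ℓ
prodCoeff≡e (suc n′) ℓ _ ℓ≥ ℓ≤ with ℓ ℕ.<? 4 * suc n′ | ℓ ℕ.≤? 4 * suc n′ + 1 | ℓ ℕ.≤? 6 * suc n′
... | yes ℓ<4n | _        | _        = prodCoeff-range₁ n′ ℓ ℓ≥ ℓ<4n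
... | no ℓ≮4n  | yes ℓ≤₁  | _        = prodCoeff-range₂ n′ ℓ ℓ≥ ℓ≮4n ℓ≤₁
... | no _     | no ℓ≰₁   | yes ℓ≤₂  = prodCoeff-range₃ n′ ℓ ℓ≥ ℓ≰₁ ℓ≤₂
... | no _     | no ℓ≰₁   | no ℓ≰₂   = prodCoeff-range₄ n′ ℓ ℓ≥ ℓ≰₁ ℓ≰₂ ℓ≤

triangle-closed : ∀ a → + 2 ℤ.* triangle a ≡ + 3 ℤ.* + a ℤ.* (+ a ℤ.+ + 1)
triangle-closed zero    = refl
triangle-closed (suc a) = begin
  + 2 ℤ.* (triangle a ℤ.+ + (3 * suc a))                             ≡⟨ ℤₚ.*-distribˡ-+ (+ 2) (triangle a) _ ⟩
  + 2 ℤ.* triangle a ℤ.+ + 2 ℤ.* + (3 * suc a)                       ≡⟨ cong₂ ℤ._+_ (triangle-closed a) (cong (+ 2 ℤ.*_) (trans (sym (ℤₚ.pos-* 3 (suc a))) (cong (+ 3 ℤ.*_) (ℤₚ.pos-+ 1 a)))) ⟩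
  + 3 ℤ.* + a ℤ.* (+ a ℤ.+ + 1) ℤ.+ + 2 ℤ.* (+ 3 ℤ.* (+ 1 ℤ.+ + a))  ≡⟨ step (+ a) ⟩
  + 3 ℤ.* (+ 1 ℤ.+ + a) ℤ.* ((+ 1 ℤ.+ + a) ℤ.+ + 1)                  ≡⟨ cong (λ z → + 3 ℤ.* z ℤ.* (z ℤ.+ + 1)) (sym (ℤₚ.pos-+ 1 a)) ⟩
  + 3 ℤ.* + suc a ℤ.* (+ suc a ℤ.+ + 1)                              ∎
  where
  open ≡-Reasoning
  step : ∀ a → + 3 ℤ.* a ℤ.* (a ℤ.+ + 1) ℤ.+ + 2 ℤ.* (+ 3 ℤ.* (+ 1 ℤ.+ a)) ≡ + 3 ℤ.* (+ 1 ℤ.+ a) ℤ.* ((+ 1 ℤ.+ a) ℤ.+ + 1)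
  step = ℤSolver.solve-∀

0≤* : ∀ a b → + 0 ℤ.≤ a → + 0 ℤ.≤ b → + 0 ℤ.≤ a ℤ.* b
0≤* a b 0≤a 0≤b = subst₂ (λ u v → + 0 ℤ.≤ u ℤ.* v) (ℤₚ.0≤i⇒+∣i∣≡i 0≤a) (ℤₚ.0≤i⇒+∣i∣≡i 0≤b)
                    (subst (+ 0 ℤ.≤_) (ℤₚ.pos-* ℤ.∣ a ∣ ℤ.∣ b ∣) (ℤ.+≤+ z≤n))

private

  0<diff⇒< : ∀ p q → + 0 ℤ.< q ℤ.- p → p ℤ.< q
  0<diff⇒< p q 0<q-p = subst₂ ℤ._<_ (ℤₚ.+-identityʳ p) (add-back p q) (ℤₚ.+-monoʳ-< p 0<q-p)
    where add-back : ∀ p q → p ℤ.+ (q ℤ.- p) ≡ q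
          add-back = ℤSolver.solve-∀

  +-cancelˡ-< : ∀ a b c → a ℤ.+ b ℤ.< a ℤ.+ c → b ℤ.< c
  +-cancelˡ-< a b c lt = subst₂ ℤ._<_ (cancel a b) (cancel a c) (ℤₚ.+-monoʳ-< (ℤ.- a) lt)
    where cancel : ∀ a b → ℤ.- a ℤ.+ (a ℤ.+ b) ≡ b
          cancel = ℤSolver.solve-∀

  <⇒0<diff : ∀ {p q} → p ℤ.< q → + 0 ℤ.< q ℤ.- p
  <⇒0<diff {p} lt = subst₂ ℤ._<_ (ℤₚ.+-inverseʳ p) refl (ℤₚ.+-monoˡ-< (ℤ.- p) lt)

chord-gap : ∀ i y x (Eᵢ Eⱼ Eₙ : ℤ) →
  + 2 ℤ.* (+ x ℤ.* (triangle i ℤ.+ Eᵢ) ℤ.+ + y ℤ.* (triangle (i + y + x) ℤ.+ Eⱼ)) ℤ.- + 2 ℤ.* ((+ x ℤ.+ + y) ℤ.* (triangle (i + y) ℤ.+ Eₙ))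
  ≡ + 3 ℤ.* + x ℤ.* + y ℤ.* (+ x ℤ.+ + y) ℤ.+ (+ 2 ℤ.* + x ℤ.* Eᵢ ℤ.+ + 2 ℤ.* + y ℤ.* Eⱼ ℤ.- + 2 ℤ.* (+ x ℤ.+ + y) ℤ.* Eₙ)
chord-gap i y x Eᵢ Eⱼ Eₙ = begin
  + 2 ℤ.* (A ℤ.* (T₀ ℤ.+ Eᵢ) ℤ.+ B ℤ.* (T₂ ℤ.+ Eⱼ)) ℤ.- + 2 ℤ.* ((A ℤ.+ B) ℤ.* (T₁ ℤ.+ Eₙ))
    ≡⟨ separate A B T₀ T₁ T₂ Eᵢ Eⱼ Eₙ ⟩
  A ℤ.* (+ 2 ℤ.* T₀) ℤ.+ B ℤ.* (+ 2 ℤ.* T₂) ℤ.- (A ℤ.+ B) ℤ.* (+ 2 ℤ.* T₁) ℤ.+ R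
    ≡⟨ cong₃ (triangle-closed i) (trans (triangle-closed (i + y + x)) (cong cubic j≡)) (trans (triangle-closed (i + y)) (cong cubic n≡)) ⟩
  A ℤ.* cubic I ℤ.+ B ℤ.* cubic (I ℤ.+ B ℤ.+ A) ℤ.- (A ℤ.+ B) ℤ.* cubic (I ℤ.+ B) ℤ.+ R
    ≡⟨ expand I A B R ⟩
  + 3 ℤ.* A ℤ.* B ℤ.* (A ℤ.+ B) ℤ.+ R
    ∎
  where
  open ≡-Reasoning
  A = + x
  B = + y
  I = + i
  T₀ = triangle i
  T₁ = triangle (i + y)
  T₂ = triangle (i + y + x)
  R = + 2 ℤ.* A ℤ.* Eᵢ ℤ.+ + 2 ℤ.* B ℤ.* Eⱼ ℤ.- + 2 ℤ.* (A ℤ.+ B) ℤ.* Eₙ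
  cubic : ℤ → ℤ
  cubic m = + 3 ℤ.* m ℤ.* (m ℤ.+ + 1)
  n≡ : + (i + y) ≡ I ℤ.+ B
  n≡ = ℤₚ.pos-+ i y
  j≡ : + (i + y + x) ≡ I ℤ.+ B ℤ.+ A
  j≡ = trans (ℤₚ.pos-+ (i + y) x) (cong (ℤ._+ A) n≡)
  cong₃ : ∀ {a a′ b b′ c c′ : ℤ} → a ≡ a′ → b ≡ b′ → c ≡ c′ →
          A ℤ.* a ℤ.+ B ℤ.* b ℤ.- (A ℤ.+ B) ℤ.* c ℤ.+ R ≡ A ℤ.* a′ ℤ.+ B ℤ.* b′ ℤ.- (A ℤ.+ B) ℤ.* c′ ℤ.+ R
  cong₃ refl refl refl = refl
  separate : ∀ A B T₀ T₁ T₂ Eᵢ Eⱼ Eₙ →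
    + 2 ℤ.* (A ℤ.* (T₀ ℤ.+ Eᵢ) ℤ.+ B ℤ.* (T₂ ℤ.+ Eⱼ)) ℤ.- + 2 ℤ.* ((A ℤ.+ B) ℤ.* (T₁ ℤ.+ Eₙ))
    ≡ A ℤ.* (+ 2 ℤ.* T₀) ℤ.+ B ℤ.* (+ 2 ℤ.* T₂) ℤ.- (A ℤ.+ B) ℤ.* (+ 2 ℤ.* T₁)
      ℤ.+ (+ 2 ℤ.* A ℤ.* Eᵢ ℤ.+ + 2 ℤ.* B ℤ.* Eⱼ ℤ.- + 2 ℤ.* (A ℤ.+ B) ℤ.* Eₙ)
  separate = ℤSolver.solve-∀
  expand : ∀ I A B R →
    A ℤ.* (+ 3 ℤ.* I ℤ.* (I ℤ.+ + 1)) ℤ.+ B ℤ.* (+ 3 ℤ.* (I ℤ.+ B ℤ.+ A) ℤ.* ((I ℤ.+ B ℤ.+ A) ℤ.+ + 1))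
      ℤ.- (A ℤ.+ B) ℤ.* (+ 3 ℤ.* (I ℤ.+ B) ℤ.* ((I ℤ.+ B) ℤ.+ + 1)) ℤ.+ R
    ≡ + 3 ℤ.* A ℤ.* B ℤ.* (A ℤ.+ B) ℤ.+ R
  expand = ℤSolver.solve-∀

chord-gap-pos : ∀ i y x (Eᵢ Eⱼ Eₙ : ℤ) → 1 ≤ y → + 0 ℤ.≤ Eᵢ → + 0 ℤ.≤ Eⱼ → + 2 ℤ.* Eₙ ℤ.< + 3 ℤ.* + x →
  + (x + y) ℤ.* (triangle (i + y) ℤ.+ Eₙ) ℤ.< + x ℤ.* (triangle i ℤ.+ Eᵢ) ℤ.+ + y ℤ.* (triangle (i + y + x) ℤ.+ Eⱼ)
chord-gap-pos i y x Eᵢ Eⱼ Eₙ 1≤y 0≤Eᵢ 0≤Eⱼ 2Eₙ<3x =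
  ℤₚ.*-cancelˡ-<-nonNeg (+ 2) (0<diff⇒< _ _ (subst (+ 0 ℤ.<_) (sym gap) (ℤₚ.+-mono-<-≤ cubic-wins ends-nonneg)))
  where
  A = + x
  B = + y
  x+y≡ : + (x + y) ≡ A ℤ.+ B
  x+y≡ = ℤₚ.pos-+ x y
  gap = trans (cong (λ z → + 2 ℤ.* (A ℤ.* (triangle i ℤ.+ Eᵢ) ℤ.+ B ℤ.* (triangle (i + y + x) ℤ.+ Eⱼ)) ℤ.- + 2 ℤ.* (z ℤ.* (triangle (i + y) ℤ.+ Eₙ))) x+y≡)
              (trans (chord-gap i y x Eᵢ Eⱼ Eₙ) (regroup (A ℤ.+ B) Eₙ (+ 3 ℤ.* A ℤ.* B) (+ 2 ℤ.* A ℤ.* Eᵢ ℤ.+ + 2 ℤ.* B ℤ.* Eⱼ)))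
    where
    regroup : ∀ s e u r → u ℤ.* s ℤ.+ (r ℤ.- + 2 ℤ.* s ℤ.* e) ≡ (s ℤ.* u ℤ.- s ℤ.* (+ 2 ℤ.* e)) ℤ.+ r
    regroup = ℤSolver.solve-∀
  -- (x + y)·2E_n < (x + y)·3x ≤ (x + y)·3xy
  3x≤3xy : + 3 ℤ.* A ℤ.≤ + 3 ℤ.* A ℤ.* B
  3x≤3xy = subst (ℤ._≤ + 3 ℤ.* A ℤ.* B) (ℤₚ.*-identityʳ (+ 3 ℤ.* A))
             (ℤₚ.*-monoˡ-≤-nonNeg (+ 3 ℤ.* A) {{ℤ.nonNegative (0≤* (+ 3) A (ℤ.+≤+ z≤n) (ℤ.+≤+ z≤n))}} (ℤ.+≤+ 1≤y))
  cubic-wins : + 0 ℤ.< (A ℤ.+ B) ℤ.* (+ 3 ℤ.* A ℤ.* B) ℤ.- (A ℤ.+ B) ℤ.* (+ 2 ℤ.* Eₙ)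
  cubic-wins = <⇒0<diff (subst (λ z → z ℤ.* (+ 2 ℤ.* Eₙ) ℤ.< z ℤ.* (+ 3 ℤ.* A ℤ.* B)) x+y≡
                 (ℤₚ.*-monoˡ-<-pos (+ (x + y)) {{x+y-pos}} (ℤₚ.<-≤-trans 2Eₙ<3x 3x≤3xy)))
    where
    x+y-pos : ℤ.Positive (+ (x + y))
    x+y-pos = ℤ.positive (ℤ.+<+ (ℕₚ.≤-trans 1≤y (ℕₚ.m≤n+m y x)))
  ends-nonneg : + 0 ℤ.≤ + 2 ℤ.* A ℤ.* Eᵢ ℤ.+ + 2 ℤ.* B ℤ.* Eⱼ
  ends-nonneg = ℤₚ.+-mono-≤ (0≤* (+ 2 ℤ.* A) Eᵢ (0≤* (+ 2) A (ℤ.+≤+ z≤n) (ℤ.+≤+ z≤n)) 0≤Eᵢ)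
                            (0≤* (+ 2 ℤ.* B) Eⱼ (0≤* (+ 2) B (ℤ.+≤+ z≤n) (ℤ.+≤+ z≤n)) 0≤Eⱼ)

below-chord : ∀ i n j (Eᵢ Eⱼ Eₙ : ℤ) → i < n → n < j → + 0 ℤ.≤ Eᵢ → + 0 ℤ.≤ Eⱼ →
  + (3 * n) ℤ.+ + 2 ℤ.* Eₙ ℤ.< + (3 * j) →
  + (j ∸ i) ℤ.* (triangle n ℤ.+ Eₙ) ℤ.< + (j ∸ n) ℤ.* (triangle i ℤ.+ Eᵢ) ℤ.+ + (n ∸ i) ℤ.* (triangle j ℤ.+ Eⱼ)
below-chord i n j Eᵢ Eⱼ Eₙ i<n n<j 0≤Eᵢ 0≤Eⱼ small =
  subst₂ ℤ._<_ (cong₂ (λ a b → + a ℤ.* (triangle b ℤ.+ Eₙ)) (sym j∸i≡) (sym n≡))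
               (cong (λ b → + (j ∸ n) ℤ.* (triangle i ℤ.+ Eᵢ) ℤ.+ + (n ∸ i) ℤ.* (triangle b ℤ.+ Eⱼ)) (sym j≡))
    (chord-gap-pos i (n ∸ i) (j ∸ n) Eᵢ Eⱼ Eₙ (ℕₚ.m<n⇒0<n∸m i<n) 0≤Eᵢ 0≤Eⱼ 2Eₙ<3x)
  where
  n≡ : n ≡ i + (n ∸ i)
  n≡ = sym (ℕₚ.m+[n∸m]≡n (ℕₚ.<⇒≤ i<n))
  j≡ : j ≡ i + (n ∸ i) + (j ∸ n)
  j≡ = trans (sym (ℕₚ.m+[n∸m]≡n (ℕₚ.<⇒≤ n<j))) (cong (_+ (j ∸ n)) n≡)
  j∸i≡ : j ∸ i ≡ (j ∸ n) + (n ∸ i)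
  j∸i≡ = trans (cong (_∸ i) (trans j≡ (ℕₚ.+-assoc i (n ∸ i) (j ∸ n))))
               (trans (ℕₚ.m+n∸m≡n i ((n ∸ i) + (j ∸ n))) (ℕₚ.+-comm (n ∸ i) (j ∸ n)))
  -- 3j = 3n + 3x, so the hypothesis says 2E_n < 3x
  2Eₙ<3x : + 2 ℤ.* Eₙ ℤ.< + 3 ℤ.* + (j ∸ n)
  2Eₙ<3x = +-cancelˡ-< (+ (3 * n)) (+ 2 ℤ.* Eₙ) (+ 3 ℤ.* + (j ∸ n)) (subst (+ (3 * n) ℤ.+ + 2 ℤ.* Eₙ ℤ.<_) 3j≡ small)
    where
    3j≡ : + (3 * j) ≡ + (3 * n) ℤ.+ + 3 ℤ.* + (j ∸ n)
    3j≡ = trans (cong (λ z → + (3 * z)) (sym (ℕₚ.m+[n∸m]≡n (ℕₚ.<⇒≤ n<j))))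
                (trans (cong +_ (ℕₚ.*-distribˡ-+ 3 n (j ∸ n))) (trans (ℤₚ.pos-+ (3 * n) _) (cong (λ z → + (3 * n) ℤ.+ z) (ℤₚ.pos-* 3 (j ∸ n)))))

dimS≤ : ∀ k → dimS k ≤ k / 6
dimS≤ k with k % 6 ℕ.≡ᵇ 1
... | true  = ℕₚ.m∸n≤m _ 1
... | false = ℕₚ.≤-refl

dimS-on : ∀ k → k % 6 ≡ 1 → dimS k ≡ k / 6 ∸ 1
dimS-on k k%6≡1 with k % 6 ℕ.≡ᵇ 1 in eq
... | true  = refl
... | false = ⊥-elim (subst T eq (subst (λ z → T (z ℕ.≡ᵇ 1)) (sym k%6≡1) tt))

6t≤k : ∀ k t → t ≤ dimS k → 6 * t ≤ k
6t≤k k t t≤m = subst (_≤ k) (ℕₚ.*-comm t 6) (≤/⇒*≤ t k 6 (ℕₚ.≤-trans t≤m (dimS≤ k)))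

-- Every index 1 ≤ t ≤ m is admissible: k = 6t + 1 would force m = t − 1.
admissible : ∀ k t → 1 ≤ t → t ≤ dimS k → Admissible k t
admissible k t 1≤t t≤m = k ∸ 6 * t , sym (ℕₚ.m+[n∸m]≡n (6t≤k k t t≤m)) , r≢1
  where
  r≢1 : k ∸ 6 * t ≢ 1
  r≢1 r≡1 = ℕₚ.<-irrefl refl (ℕₚ.≤-<-trans (subst (t ≤_) m≡ t≤m) (pred< t 1≤t))
    where
    pred< : ∀ t → 1 ≤ t → t ∸ 1 < t
    pred< (suc t) _ = ℕₚ.≤-refl
    k≡ : k ≡ suc (6 * t)
    k≡ = trans (sym (ℕₚ.m+[n∸m]≡n (6t≤k k t t≤m))) (trans (cong (λ z → 6 * t + z) r≡1) (ℕₚ.+-comm (6 * t) 1))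
    k/6≡ : k / 6 ≡ t
    k/6≡ = trans (cong (_/ 6) (trans k≡ (cong suc (ℕₚ.*-comm 6 t))))
                 (trans (ℕ÷.+-distrib-/-∣ʳ 1 {t * 6} {6} (ℕ∣.divides t refl)) (ℕ÷.m*n/n≡m t 6))
    m≡ : dimS k ≡ t ∸ 1
    m≡ = trans (dimS-on k (trans (cong (_% 6) k≡) (1+6t%6 t))) (cong (_∸ 1) k/6≡)

PBC-inside : ∀ k i → i ≤ dimS k → PBC k i ≡ prodBC k i
PBC-inside k i i≤m with i ≤ᵇ dimS k in eq
... | true  = refl
... | false = ⊥-elim (subst T eq (ℕₚ.≤⇒≤ᵇ i≤m))

PBC-support : ∀ k i → PBC k i ≢ 0ℚ → i ≤ dimS k
PBC-support k i ≢0 with i ≤ᵇ dimS k in eq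
... | true  = ℕₚ.≤ᵇ⇒≤ i (dimS k) (subst T (sym eq) tt)
... | false = ⊥-elim (≢0 refl)

-- The perturbation E k i = Σ_ℓ prodCoeff i ℓ · v₂|k − ℓ| (ℓ < k + 2 suffices).
E : ℕ → ℕ → ℤ
E k i = weighted (weight k) (prodCoeff i) (k + 2)

PBC-valuation : ∀ k i → i ≤ dimS k → (PBC k i ≢ 0ℚ) × (v2ℚ (PBC k i) ≡ triangle i ℤ.+ E k i)
PBC-valuation k i i≤m = subst (λ c → (c ≢ 0ℚ) × (v2ℚ c ≡ triangle i ℤ.+ E k i)) (sym (PBC-inside k i i≤m))
  (prod-linear k i (k + 2) (λ t 1≤t t≤i → admissible k t 1≤t (ℕₚ.≤-trans t≤i i≤m)) (ℕₚ.+-monoˡ-≤ 2 (6t≤k k i i≤m)))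

E-nonneg : ∀ k i → + 0 ℤ.≤ E k i
E-nonneg k i = Σ<-nonneg _ (k + 2) (λ ℓ _ → 0≤* (prodCoeff i ℓ) (weight k ℓ) (prodCoeff-nonneg i ℓ) (ℤ.+≤+ z≤n))

Σ<-shift : ∀ f N → Σ< f (suc N) ≡ f 0 ℤ.+ Σ< (λ d → f (suc d)) N
Σ<-shift f zero    = trans (ℤₚ.+-identityˡ (f 0)) (sym (ℤₚ.+-identityʳ (f 0)))
Σ<-shift f (suc N) = trans (cong (ℤ._+ f (suc N)) (Σ<-shift f N)) (ℤₚ.+-assoc (f 0) _ _)

foldr-applyUpTo : ∀ (h : ℕ → ℤ) N → foldr ℤ._+_ (+ 0) (applyUpTo h N) ≡ Σ< h N
foldr-applyUpTo h zero    = refl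
foldr-applyUpTo h (suc N) = trans (cong (λ z → h 0 ℤ.+ z) (foldr-applyUpTo (λ d → h (suc d)) N)) (sym (Σ<-shift h N))

sumE-term : ℕ → ℕ → ℕ → ℤ
sumE-term k n ℓ = if ℓ ℕ.≡ᵇ k then + 0 else e n ℓ ℤ.* (+ v2ℕ ∣ k - ℓ ∣)

sumE≡Σ< : ∀ k n → sumE k n ≡ Σ< (λ d → sumE-term k n (3 * n + 4 + d)) ((6 * n + 2) ∸ (3 * n + 4))
sumE≡Σ< k n = begin
  foldr ℤ._+_ (+ 0) (map F (map (λ d → a + d) (upTo N)))   ≡⟨ cong (foldr ℤ._+_ (+ 0)) (sym (Listₚ.map-∘ (upTo N))) ⟩
  foldr ℤ._+_ (+ 0) (map (λ d → F (a + d)) (upTo N))       ≡⟨ cong (foldr ℤ._+_ (+ 0)) (Listₚ.map-upTo (λ d → F (a + d)) N) ⟩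
  foldr ℤ._+_ (+ 0) (applyUpTo (λ d → F (a + d)) N)        ≡⟨ foldr-applyUpTo (λ d → F (a + d)) N ⟩
  Σ< (λ d → F (a + d)) N                                   ∎
  where
  open ≡-Reasoning
  F = sumE-term k n
  a = 3 * n + 4
  N = (6 * n + 2) ∸ (3 * n + 4)

-- For 1 ≤ n ≤ m, E k n equals the sum S = Σ_{3n+4 ≤ ℓ ≤ 6n+1} e_{n,ℓ} v₂(k − ℓ):
-- outside this range prodCoeff vanishes, inside it equals e, and the term
-- ℓ = k carries weight v₂(0) = 0 on both sides.
E≡sumE : ∀ k n → 1 ≤ n → n ≤ dimS k → E k n ≡ sumE k n
E≡sumE k n 1≤n n≤m = begin
  Σ< H (k + 2)                                        ≡⟨ cong (Σ< H) k+2≡ ⟩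
  Σ< H (a + (N + R))                                  ≡⟨ Σ<-split H a (N + R) ⟩
  Σ< H a ℤ.+ Σ< (λ d → H (a + d)) (N + R)             ≡⟨ cong₂ ℤ._+_ low (Σ<-split (λ d → H (a + d)) N R) ⟩
  + 0 ℤ.+ (Σ< (λ d → H (a + d)) N ℤ.+ Σ< (λ d → H (a + (N + d))) R)
                                                      ≡⟨ cong (λ z → + 0 ℤ.+ (Σ< (λ d → H (a + d)) N ℤ.+ z)) high ⟩
  + 0 ℤ.+ (Σ< (λ d → H (a + d)) N ℤ.+ + 0)            ≡⟨ trans (ℤₚ.+-identityˡ _) (ℤₚ.+-identityʳ _) ⟩
  Σ< (λ d → H (a + d)) N                              ≡⟨ Σ<-cong N middle ⟩
  Σ< (λ d → sumE-term k n (a + d)) N                  ≡⟨ sym (sumE≡Σ< k n) ⟩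
  sumE k n                                            ∎
  where
  open ≡-Reasoning
  H = λ ℓ → prodCoeff n ℓ ℤ.* weight k ℓ
  a = 3 * n + 4
  N = (6 * n + 2) ∸ (3 * n + 4)
  R = (k + 2) ∸ (6 * n + 2)
  a≤ : a ≤ 6 * n + 2
  a≤ = bound n 1≤n
    where
    bound : ∀ n → 1 ≤ n → 3 * n + 4 ≤ 6 * n + 2
    bound (suc n′) _ = ≤-of-sum (3 * suc n′ + 4) (3 * n′ + 1) (eq n′)
      where eq : ∀ n′ → 6 * suc n′ + 2 ≡ 3 * suc n′ + 4 + (3 * n′ + 1)
            eq = solve-∀
  k+2≡ : k + 2 ≡ a + (N + R)
  k+2≡ = sym (trans (sym (ℕₚ.+-assoc a N R)) (trans (cong (_+ R) (ℕₚ.m+[n∸m]≡n a≤)) (ℕₚ.m+[n∸m]≡n (ℕₚ.+-monoˡ-≤ 2 (6t≤k k n n≤m)))))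
  low : Σ< H a ≡ + 0
  low = Σ<-zero H a (λ ℓ ℓ<a → trans (cong (ℤ._* weight k ℓ) (prodCoeff-low n ℓ (ℕₚ.≤-pred (subst (ℓ <_) (eq n) ℓ<a)))) (ℤₚ.*-zeroˡ (weight k ℓ)))
    where eq : ∀ n → 3 * n + 4 ≡ suc (3 * n + 3)
          eq = solve-∀
  high : Σ< (λ d → H (a + (N + d))) R ≡ + 0
  high = Σ<-zero _ R (λ d _ → trans (cong (ℤ._* weight k (a + (N + d))) (prodCoeff-high n (a + (N + d)) beyond)) (ℤₚ.*-zeroˡ (weight k (a + (N + d)))))
    where
    beyond : ∀ {d} → 6 * n + 2 ≤ a + (N + d)
    beyond {d} = ℕₚ.≤-trans (ℕₚ.≤-reflexive (sym (ℕₚ.m+[n∸m]≡n a≤))) (ℕₚ.+-monoʳ-≤ a (ℕₚ.m≤m+n N d))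
  middle : ∀ d → d < N → H (a + d) ≡ sumE-term k n (a + d)
  middle d d<N with (a + d) ℕ.≡ᵇ k in ℓ≟k
  ... | true  = trans (cong (λ z → prodCoeff n (a + d) ℤ.* + v2ℕ ∣ k - z ∣) ℓ≡k)
                      (trans (cong (λ z → prodCoeff n (a + d) ℤ.* + v2ℕ z) (ℕₚ.∣n-n∣≡0 k)) (ℤₚ.*-zeroʳ (prodCoeff n (a + d))))
    where ℓ≡k = ℕₚ.≡ᵇ⇒≡ (a + d) k (subst T (sym ℓ≟k) tt)
  ... | false = cong (ℤ._* weight k (a + d)) (prodCoeff≡e n (a + d) 1≤n (ℕₚ.m≤m+n a d) ℓ≤)
    where
    ℓ≤ : a + d ≤ 6 * n + 1
    ℓ≤ = ℕₚ.≤-pred (ℕₚ.≤-trans (ℕₚ.≤-reflexive (sym (ℕₚ.+-suc a d)))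
                   (ℕₚ.≤-trans (ℕₚ.+-monoʳ-≤ a d<N) (ℕₚ.≤-trans (ℕₚ.≤-reflexive (ℕₚ.m+[n∸m]≡n a≤)) (ℕₚ.≤-reflexive (top n)))))
      where top : ∀ n → 6 * n + 2 ≡ suc (6 * n + 1)
            top = solve-∀

PBC-below-chord : ∀ k n i j → 1 ≤ n → i < n → n < j → j ≤ dimS k →
  + (3 * n) ℤ.+ + 2 ℤ.* sumE k n ℤ.< + (3 * j) →
  + (j ∸ i) ℤ.* v2ℚ (PBC k n) ℤ.< + (j ∸ n) ℤ.* v2ℚ (PBC k i) ℤ.+ + (n ∸ i) ℤ.* v2ℚ (PBC k j)
PBC-below-chord k n i j 1≤n i<n n<j j≤m j>M =
  subst₂ ℤ._<_ (cong (+ (j ∸ i) ℤ.*_) (sym (val n n≤m)))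
               (cong₂ (λ u v → + (j ∸ n) ℤ.* u ℤ.+ + (n ∸ i) ℤ.* v) (sym (val i i≤m)) (sym (val j j≤m)))
    (below-chord i n j (E k i) (E k j) (E k n) i<n n<j (E-nonneg k i) (E-nonneg k j)
      (subst (λ z → + (3 * n) ℤ.+ + 2 ℤ.* z ℤ.< + (3 * j)) (sym (E≡sumE k n 1≤n n≤m)) j>M))
  where
  n≤m = ℕₚ.<⇒≤ (ℕₚ.<-≤-trans n<j j≤m)
  i≤m = ℕₚ.<⇒≤ (ℕₚ.<-≤-trans i<n n≤m)
  val : ∀ x → x ≤ dimS k → v2ℚ (PBC k x) ≡ triangle x ℤ.+ E k x
  val x x≤m = proj₂ (PBC-valuation k x x≤m)

BelowChord : (ℕ → ℚ) → ℕ → ℕ → ℕ → Set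
BelowChord c n i j = + (j ∸ i) ℤ.* v2ℚ (c n) ℤ.< + (j ∸ n) ℤ.* v2ℚ (c i) ℤ.+ + (n ∸ i) ℤ.* v2ℚ (c j)

BelowChord-cong : ∀ {c d} n i j → c n ≡ d n → c i ≡ d i → c j ≡ d j → BelowChord c n i j → BelowChord d n i j
BelowChord-cong {c} {d} n i j eₙ eᵢ eⱼ = subst (λ z → + (j ∸ i) ℤ.* v2ℚ z ℤ.< + (j ∸ n) ℤ.* v2ℚ (d i) ℤ.+ + (n ∸ i) ℤ.* v2ℚ (d j)) eₙ
  ∘′ subst (λ z → + (j ∸ i) ℤ.* v2ℚ (c n) ℤ.< + (j ∸ n) ℤ.* v2ℚ z ℤ.+ + (n ∸ i) ℤ.* v2ℚ (d j)) eᵢ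
  ∘′ subst (λ z → + (j ∸ i) ℤ.* v2ℚ (c n) ℤ.< + (j ∸ n) ℤ.* v2ℚ (c i) ℤ.+ + (n ∸ i) ℤ.* v2ℚ z) eⱼ

trunc-kept : ∀ c keep i → keep i ≡ true → trunc c keep i ≡ c i
trunc-kept c keep i kept rewrite kept = refl

trunc-support : ∀ c keep i → trunc c keep i ≢ 0ℚ → keep i ≡ true
trunc-support c keep i ≢0 with keep i
... | true  = refl
... | false = ⊥-elim (≢0 refl)

-- Chords into dropped degrees are
-- then the only difference between the two conditions.
vertex-truncation : ∀ c keep n →
  (c n ≢ 0ℚ → ∀ i → i ≤ n → keep i ≡ true) →
  (∀ i j → i < n → n < j → keep j ≡ false → c n ≢ 0ℚ → c i ≢ 0ℚ → c j ≢ 0ℚ → BelowChord c n i j) →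
  IsVertex c n ⇔ IsVertex (trunc c keep) n
vertex-truncation c keep n prefix dropped = mk⇔ to from
  where
  d = trunc c keep
  same : ∀ i → keep i ≡ true → d i ≡ c i
  same = trunc-kept c keep
  to : IsVertex c n → IsVertex d n
  to (cₙ≢0 , below) = (λ dₙ≡0 → cₙ≢0 (trans (sym d≡c) dₙ≡0)) , below′
    where
    d≡c = same n (prefix cₙ≢0 n ℕₚ.≤-refl)
    below′ : ∀ i j → i < n → n < j → d i ≢ 0ℚ → d j ≢ 0ℚ → BelowChord d n i j
    below′ i j i<n n<j dᵢ≢0 dⱼ≢0 =
      BelowChord-cong n i j (sym d≡c) (sym (same i kᵢ)) (sym (same j kⱼ))
        (below i j i<n n<j (λ e → dᵢ≢0 (trans (same i kᵢ) e)) (λ e → dⱼ≢0 (trans (same j kⱼ) e)))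
      where
      kᵢ = trunc-support c keep i dᵢ≢0
      kⱼ = trunc-support c keep j dⱼ≢0
  from : IsVertex d n → IsVertex c n
  from (dₙ≢0 , below) = cₙ≢0 , below′
    where
    d≡c = same n (trunc-support c keep n dₙ≢0)
    cₙ≢0 : c n ≢ 0ℚ
    cₙ≢0 e = dₙ≢0 (trans d≡c e)
    below′ : ∀ i j → i < n → n < j → c i ≢ 0ℚ → c j ≢ 0ℚ → BelowChord c n i j
    below′ i j i<n n<j cᵢ≢0 cⱼ≢0 with keep j in kⱼ
    ... | false = dropped i j i<n n<j kⱼ cₙ≢0 cᵢ≢0 cⱼ≢0
    ... | true  = BelowChord-cong n i j d≡c dᵢ≡cᵢ (same j kⱼ)
                    (below i j i<n n<j (λ e → cᵢ≢0 (trans (sym dᵢ≡cᵢ) e)) (λ e → cⱼ≢0 (trans (sym (same j kⱼ)) e)))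
      where
      dᵢ≡cᵢ = same i (prefix cₙ≢0 i (ℕₚ.<⇒≤ i<n))

-- The truncation degree M = n + (2/3)S for P_BC: every degree ≤ n is kept
-- (S ≥ 0), and every dropped degree j satisfies 3j > 3n + 2S.
module _ (k n : ℕ) (1≤n : 1 ≤ n) where
  private
    bound = + (3 * n) ℤ.+ + 2 ℤ.* sumE k n

    ∨-true : ∀ a {b} → b ≡ true → a ∨ b ≡ true
    ∨-true false b≡ = b≡
    ∨-true true  _  = refl

    ∨-false : ∀ a {b} → a ∨ b ≡ false → b ≡ false
    ∨-false false b≡ = b≡

    T-true : ∀ {b} → T b → b ≡ true
    T-true {true} _ = refl

  ≤M-prefix : PBC k n ≢ 0ℚ → ∀ i → i ≤ n → ≤M k n i ≡ true
  ≤M-prefix cₙ≢0 i i≤n = ∨-true (Minfinite k n) (T-true (ℤₚ.≤⇒≤ᵇ (ℤₚ.≤-trans (ℤ.+≤+ (ℕₚ.*-monoʳ-≤ 3 i≤n)) 3n≤bound)))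
    where
    S≥0 : + 0 ℤ.≤ sumE k n
    S≥0 = subst (+ 0 ℤ.≤_) (E≡sumE k n 1≤n (PBC-support k n cₙ≢0)) (E-nonneg k n)
    3n≤bound : + (3 * n) ℤ.≤ bound
    3n≤bound = ℤₚ.i≤i+j (+ (3 * n)) (+ 2 ℤ.* sumE k n) {{ℤ.nonNegative (0≤* (+ 2) (sumE k n) (ℤ.+≤+ z≤n) S≥0)}}

  ≤M-dropped : ∀ i j → i < n → n < j → ≤M k n j ≡ false →
               PBC k n ≢ 0ℚ → PBC k i ≢ 0ℚ → PBC k j ≢ 0ℚ → BelowChord (PBC k) n i j
  ≤M-dropped i j i<n n<j dropped _ _ cⱼ≢0 =
    PBC-below-chord k n i j 1≤n i<n n<j (PBC-support k j cⱼ≢0) (ℤₚ.≰⇒> j≰)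
    where
    j≰ : ¬ (+ (3 * j) ℤ.≤ bound)
    j≰ le = subst T (∨-false (Minfinite k n) dropped) (ℤₚ.≤⇒≤ᵇ le)

toℚ : ℤ → ℚ
toℚ z = z ℚ./ 1

private
  mk1 : ℤ → ℚ
  mk1 z = mkℚ z 0 (ℕCoprime.sym (ℕCoprime.1-coprimeTo _))

  toℚ≡mk1 : ∀ z → toℚ z ≡ mk1 z
  toℚ≡mk1 z = ℚₚ.≃⇒≡ (ℚ.*≡* (trans (cong₂ ℤ._*_ num refl) (cong (z ℤ.*_) (sym den))))
    where
    num : ℚ.↥ (toℚ z) ≡ z
    num = trans (sym (ℤₚ.*-identityʳ _)) (trans (cong (ℚ.↥ (toℚ z) ℤ.*_) (sym (ℤGCD.gcd-zeroʳ z))) (ℚₚ.↥-/ z 1))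
    den : ℚ.↧ (toℚ z) ≡ + 1
    den = trans (sym (ℤₚ.*-identityʳ _)) (trans (cong (ℚ.↧ (toℚ z) ℤ.*_) (sym (ℤGCD.gcd-zeroʳ z))) (ℚₚ.↧-/ z 1))

toℚ-+ : ∀ a b → toℚ (a ℤ.+ b) ≡ toℚ a ℚ.+ toℚ b
toℚ-+ a b = trans (ℚₚ./-cong {a ℤ.+ b} {1} {a ℤ.* + 1 ℤ.+ b ℤ.* + 1} {1} (cong₂ ℤ._+_ (sym (ℤₚ.*-identityʳ a)) (sym (ℤₚ.*-identityʳ b))) refl)
                (sym (cong₂ ℚ._+_ (toℚ≡mk1 a) (toℚ≡mk1 b)))

toℚ-* : ∀ a b → toℚ (a ℤ.* b) ≡ toℚ a ℚ.* toℚ b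
toℚ-* a b = sym (cong₂ ℚ._*_ (toℚ≡mk1 a) (toℚ≡mk1 b))

toℚ-neg : ∀ a → toℚ (ℤ.- a) ≡ ℚ.- toℚ a
toℚ-neg a = trans (toℚ≡mk1 (ℤ.- a)) (sym (trans (cong ℚ.-_ (toℚ≡mk1 a)) (neg a)))
  where
  neg : ∀ a → ℚ.- mk1 a ≡ mk1 (ℤ.- a)
  neg (+ zero)  = refl
  neg (+ suc n) = refl
  neg -[1+ n ]  = refl

toℚ-< : ∀ {a b} → a ℤ.< b → toℚ a ℚ.< toℚ b
toℚ-< {a} {b} a<b = subst₂ ℚ._<_ (sym (toℚ≡mk1 a)) (sym (toℚ≡mk1 b)) (ℚ.*<* (subst₂ ℤ._<_ (sym (ℤₚ.*-identityʳ a)) (sym (ℤₚ.*-identityʳ b)) a<b))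

toℚ-≤ : ∀ {a b} → a ℤ.≤ b → toℚ a ℚ.≤ toℚ b
toℚ-≤ {a} {b} a≤b = subst₂ ℚ._≤_ (sym (toℚ≡mk1 a)) (sym (toℚ≡mk1 b)) (ℚ.*≤* (subst₂ ℤ._≤_ (sym (ℤₚ.*-identityʳ a)) (sym (ℤₚ.*-identityʳ b)) a≤b))

ι-∸ : ∀ a b → b ≤ a → ι (a ∸ b) ≡ ι a ℚ.- ι b
ι-∸ a b b≤a = trans (cong toℚ (sym (trans (ℤₚ.m-n≡m⊖n a b) (ℤₚ.⊖-≥ b≤a)))) (trans (toℚ-+ (+ a) (ℤ.- (+ b))) (cong (ι a ℚ.+_) (toℚ-neg (+ b))))

ι-suc : ∀ a → ι (suc a) ≡ ι a ℚ.+ 1ℚ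
ι-suc a = trans (cong toℚ (trans (cong +_ (ℕₚ.+-comm 1 a)) (ℤₚ.pos-+ a 1))) (trans (toℚ-+ (+ a) (+ 1)) (cong (ι a ℚ.+_) (toℚ≡mk1 (+ 1))))

ι-< : ∀ {a b} → a < b → ι a ℚ.< ι b
ι-< a<b = toℚ-< (ℤ.+<+ a<b)

ι-≤ : ∀ {a b} → a ≤ b → ι a ℚ.≤ ι b
ι-≤ a≤b = toℚ-≤ (ℤ.+≤+ a≤b)

lerp : ℚ → ℚ → ℚ → ℚ
lerp t p q = (1ℚ ℚ.- t) ℚ.* p ℚ.+ t ℚ.* q

module Segments where
  open ℚSolver.+-*-Solver

  0≤-diff : ∀ p q → q ℚ.≤ p → 0ℚ ℚ.≤ p ℚ.- q
  0≤-diff p q q≤p = subst₂ ℚ._≤_ (ℚₚ.+-inverseʳ q) refl (ℚₚ.+-monoˡ-≤ (ℚ.- q) q≤p)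

  0<-diff : ∀ p q → q ℚ.< p → 0ℚ ℚ.< p ℚ.- q
  0<-diff p q q<p = subst₂ ℚ._<_ (ℚₚ.+-inverseʳ q) refl (ℚₚ.+-monoˡ-< (ℚ.- q) q<p)

  diff-0≤ : ∀ p q → 0ℚ ℚ.≤ p ℚ.- q → q ℚ.≤ p
  diff-0≤ p q 0≤p-q = subst₂ ℚ._≤_ (ℚₚ.+-identityˡ q) (add-back p q) (ℚₚ.+-monoˡ-≤ q 0≤p-q)
    where add-back : ∀ p q → (p ℚ.- q) ℚ.+ q ≡ p
          add-back = solve 2 (λ p q → (p :- q) :+ q := p) refl

  0≤*ℚ : ∀ p q → 0ℚ ℚ.≤ p → 0ℚ ℚ.≤ q → 0ℚ ℚ.≤ p ℚ.* q
  0≤*ℚ p q 0≤p 0≤q = subst (ℚ._≤ p ℚ.* q) (ℚₚ.*-zeroˡ q) (ℚₚ.*-monoʳ-≤-nonNeg q {{ℚ.nonNegative 0≤q}} 0≤p)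

  lerp-swap : ∀ t p q → lerp t p q ≡ lerp (1ℚ ℚ.- t) q p
  lerp-swap = solve 3 (λ t p q → (con 1ℚ :- t) :* p :+ t :* q := (con 1ℚ :- (con 1ℚ :- t)) :* q :+ (con 1ℚ :- t) :* p) refl

  1-t∈[0,1] : ∀ t → 0ℚ ℚ.≤ t → t ℚ.≤ 1ℚ → (0ℚ ℚ.≤ 1ℚ ℚ.- t) × (1ℚ ℚ.- t ℚ.≤ 1ℚ)
  1-t∈[0,1] t 0≤t t≤1 = 0≤-diff 1ℚ t t≤1 , diff-0≤ 1ℚ (1ℚ ℚ.- t) (subst (0ℚ ℚ.≤_) (twice t) 0≤t)
    where twice : ∀ t → t ≡ 1ℚ ℚ.- (1ℚ ℚ.- t)
          twice = solve 1 (λ t → t := con 1ℚ :- (con 1ℚ :- t)) refl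

  -- If b is strictly below the chord from (a, Va) to (C, Vc) and (x, y) lies
  -- above that chord with a ≤ x ≤ b, then (x, y) lies above the chord from
  -- (a, Va) to (b, Vb): cutting a segment at a point below it only lowers it.
  shorten : ∀ a b C Va Vb Vc x y t → a ℚ.< b → b ℚ.< C →
    (C ℚ.- a) ℚ.* Vb ℚ.< (C ℚ.- b) ℚ.* Va ℚ.+ (b ℚ.- a) ℚ.* Vc →
    0ℚ ℚ.≤ t → x ≡ lerp t a C → lerp t Va Vc ℚ.≤ y → x ℚ.≤ b →
    Σ ℚ λ s → (0ℚ ℚ.≤ s) × (s ℚ.≤ 1ℚ) × (x ≡ lerp s a b) × (lerp s Va Vb ℚ.≤ y)
  shorten a b C Va Vb Vc x y t a<b b<C below 0≤t x≡ above x≤b = s , 0≤s , s≤1 , x≡′ , above′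
    where
    D = b ℚ.- a
    instance
      D-pos : ℚ.Positive D
      D-pos = ℚ.positive (0<-diff b a a<b)
      D≢0 : ℚ.NonZero D
      D≢0 = ℚₚ.pos⇒nonZero D
    -- the new parameter s = t (C − a) / (b − a)
    s = t ℚ.* (C ℚ.- a) ℚ.* (ℚ.1/ D)
    s·D : s ℚ.* D ≡ t ℚ.* (C ℚ.- a)
    s·D = trans (ℚₚ.*-assoc (t ℚ.* (C ℚ.- a)) (ℚ.1/ D) D) (trans (cong (t ℚ.* (C ℚ.- a) ℚ.*_) (ℚₚ.*-inverseˡ D)) (ℚₚ.*-identityʳ _))
    x≡′ : x ≡ lerp s a b
    x≡′ = trans x≡ (trans (from-a a C t) (trans (cong (a ℚ.+_) (trans (sym s·D) (ℚₚ.*-comm s D))) (sym (from-a′ a b s))))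
      where
      from-a : ∀ a C t → lerp t a C ≡ a ℚ.+ t ℚ.* (C ℚ.- a)
      from-a = solve 3 (λ a C t → (con 1ℚ :- t) :* a :+ t :* C := a :+ t :* (C :- a)) refl
      from-a′ : ∀ a b s → lerp s a b ≡ a ℚ.+ (b ℚ.- a) ℚ.* s
      from-a′ = solve 3 (λ a b s → (con 1ℚ :- s) :* a :+ s :* b := a :+ (b :- a) :* s) refl
    0≤s : 0ℚ ℚ.≤ s
    0≤s = 0≤*ℚ _ _ (0≤*ℚ t (C ℚ.- a) 0≤t (ℚₚ.<⇒≤ (0<-diff C a (ℚₚ.<-trans a<b b<C))))
                  (ℚₚ.<⇒≤ (ℚₚ.positive⁻¹ (ℚ.1/ D) {{ℚₚ.1/pos⇒pos D}}))
    s≤1 : s ℚ.≤ 1ℚ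
    s≤1 = ℚₚ.*-cancelʳ-≤-pos D (subst₂ ℚ._≤_ (sym (trans s·D (shift x a t C x≡))) (sym (ℚₚ.*-identityˡ D)) (ℚₚ.+-monoˡ-≤ (ℚ.- a) x≤b))
      where
      shift : ∀ x a t C → x ≡ lerp t a C → t ℚ.* (C ℚ.- a) ≡ x ℚ.- a
      shift x a t C refl = solve 3 (λ a t C → t :* (C :- a) := ((con 1ℚ :- t) :* a :+ t :* C) :- a) refl a t C
    -- D·(chord value) − D·(new value) = t·K with K > 0 the defect of b
    K = (b ℚ.- a) ℚ.* Vc ℚ.+ (C ℚ.- b) ℚ.* Va ℚ.- (C ℚ.- a) ℚ.* Vb
    0<K : 0ℚ ℚ.< K
    0<K = subst (0ℚ ℚ.<_) (reorder Va Vb Vc a b C) (0<-diff _ _ below)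
      where reorder : ∀ Va Vb Vc a b C → (C ℚ.- b) ℚ.* Va ℚ.+ (b ℚ.- a) ℚ.* Vc ℚ.- (C ℚ.- a) ℚ.* Vb ≡ (b ℚ.- a) ℚ.* Vc ℚ.+ (C ℚ.- b) ℚ.* Va ℚ.- (C ℚ.- a) ℚ.* Vb
            reorder = solve 6 (λ Va Vb Vc a b C → (C :- b) :* Va :+ (b :- a) :* Vc :- (C :- a) :* Vb := (b :- a) :* Vc :+ (C :- b) :* Va :- (C :- a) :* Vb) refl
    defect : D ℚ.* lerp t Va Vc ℚ.- D ℚ.* lerp s Va Vb ≡ t ℚ.* K
    defect = trans (expand D t s Va Vb Vc) (trans (cong (λ z → t ℚ.* (D ℚ.* (Vc ℚ.- Va)) ℚ.- z ℚ.* (Vb ℚ.- Va)) s·D) (collect t a b C Va Vb Vc))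
      where
      expand : ∀ D t s Va Vb Vc → D ℚ.* lerp t Va Vc ℚ.- D ℚ.* lerp s Va Vb ≡ t ℚ.* (D ℚ.* (Vc ℚ.- Va)) ℚ.- (s ℚ.* D) ℚ.* (Vb ℚ.- Va)
      expand = solve 6 (λ D t s Va Vb Vc → D :* ((con 1ℚ :- t) :* Va :+ t :* Vc) :- D :* ((con 1ℚ :- s) :* Va :+ s :* Vb) := t :* (D :* (Vc :- Va)) :- (s :* D) :* (Vb :- Va)) refl
      collect : ∀ t a b C Va Vb Vc → t ℚ.* ((b ℚ.- a) ℚ.* (Vc ℚ.- Va)) ℚ.- (t ℚ.* (C ℚ.- a)) ℚ.* (Vb ℚ.- Va) ≡ t ℚ.* ((b ℚ.- a) ℚ.* Vc ℚ.+ (C ℚ.- b) ℚ.* Va ℚ.- (C ℚ.- a) ℚ.* Vb)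
      collect = solve 7 (λ t a b C Va Vb Vc → t :* ((b :- a) :* (Vc :- Va)) :- (t :* (C :- a)) :* (Vb :- Va) := t :* ((b :- a) :* Vc :+ (C :- b) :* Va :- (C :- a) :* Vb)) refl
    above′ : lerp s Va Vb ℚ.≤ y
    above′ = ℚₚ.≤-trans (ℚₚ.*-cancelˡ-≤-pos D (diff-0≤ _ _ (subst (0ℚ ℚ.≤_) (sym defect) (0≤*ℚ t K 0≤t (ℚₚ.<⇒≤ 0<K))))) above

  at-start : ∀ b C Vb Vc x y t → b ℚ.< C → 0ℚ ℚ.≤ t → x ≡ lerp t b C → x ℚ.≤ b → lerp t Vb Vc ℚ.≤ y →
             (x ≡ lerp 0ℚ b b) × (lerp 0ℚ Vb Vb ℚ.≤ y)
  at-start b C Vb Vc x y t b<C 0≤t x≡ x≤b above =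
    trans x≡ (trans (cong (λ z → lerp z b C) t≡0) (ends b C)) , subst (ℚ._≤ y) (ends Vb Vc) (subst (λ z → lerp z Vb Vc ℚ.≤ y) t≡0 above)
    where
    instance
      C-b-pos : ℚ.Positive (C ℚ.- b)
      C-b-pos = ℚ.positive (0<-diff C b b<C)
    shift : t ℚ.* (C ℚ.- b) ≡ x ℚ.- b
    shift = trans (eq t b C) (cong (ℚ._- b) (sym x≡))
      where eq : ∀ t b C → t ℚ.* (C ℚ.- b) ≡ lerp t b C ℚ.- b
            eq = solve 3 (λ t b C → t :* (C :- b) := ((con 1ℚ :- t) :* b :+ t :* C) :- b) refl
    t≡0 : t ≡ 0ℚ
    t≡0 = ℚₚ.≤-antisym (ℚₚ.*-cancelʳ-≤-pos (C ℚ.- b) (subst₂ ℚ._≤_ (sym shift) (sym (ℚₚ.*-zeroˡ (C ℚ.- b)))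
                                                        (subst (x ℚ.- b ℚ.≤_) (ℚₚ.+-inverseʳ b) (ℚₚ.+-monoˡ-≤ (ℚ.- b) x≤b)))) 0≤t
    ends : ∀ p q → lerp 0ℚ p q ≡ lerp 0ℚ p p
    ends = solve 2 (λ p q → (con 1ℚ :- con 0ℚ) :* p :+ con 0ℚ :* q := (con 1ℚ :- con 0ℚ) :* p :+ con 0ℚ :* p) refl

  right-of : ∀ a b C x t → b ℚ.+ 1ℚ ℚ.≤ a → b ℚ.+ 1ℚ ℚ.≤ C → 0ℚ ℚ.≤ t → t ℚ.≤ 1ℚ → x ≡ lerp t a C → b ℚ.+ 1ℚ ℚ.≤ x
  right-of a b C x t b+1≤a b+1≤C 0≤t t≤1 x≡ = subst (b ℚ.+ 1ℚ ℚ.≤_) (sym x≡)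
    (subst (ℚ._≤ lerp t a C) (same (b ℚ.+ 1ℚ) t)
      (ℚₚ.+-mono-≤ (ℚₚ.*-monoˡ-≤-nonNeg (1ℚ ℚ.- t) {{ℚ.nonNegative (0≤-diff 1ℚ t t≤1)}} b+1≤a)
                   (ℚₚ.*-monoˡ-≤-nonNeg t {{ℚ.nonNegative 0≤t}} b+1≤C)))
    where same : ∀ u t → lerp t u u ≡ u
          same = solve 2 (λ u t → (con 1ℚ :- t) :* u :+ t :* u := u) refl

open Segments

height : (ℕ → ℚ) → ℕ → ℚ
height c i = toℚ (v2ℚ (c i))

BelowChord-ℚ : ∀ c n i j → BelowChord c n i j → i < n → n < j →
  (ι j ℚ.- ι i) ℚ.* height c n ℚ.< (ι j ℚ.- ι n) ℚ.* height c i ℚ.+ (ι n ℚ.- ι i) ℚ.* height c j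
BelowChord-ℚ c n i j below i<n n<j = subst₂ ℚ._<_ lhs rhs (toℚ-< below)
  where
  lhs : toℚ (+ (j ∸ i) ℤ.* v2ℚ (c n)) ≡ (ι j ℚ.- ι i) ℚ.* height c n
  lhs = trans (toℚ-* (+ (j ∸ i)) (v2ℚ (c n))) (cong (ℚ._* height c n) (ι-∸ j i (ℕₚ.<⇒≤ (ℕₚ.<-trans i<n n<j))))
  rhs : toℚ (+ (j ∸ n) ℤ.* v2ℚ (c i) ℤ.+ + (n ∸ i) ℤ.* v2ℚ (c j)) ≡ (ι j ℚ.- ι n) ℚ.* height c i ℚ.+ (ι n ℚ.- ι i) ℚ.* height c j
  rhs = trans (toℚ-+ (+ (j ∸ n) ℤ.* v2ℚ (c i)) (+ (n ∸ i) ℤ.* v2ℚ (c j)))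
              (cong₂ ℚ._+_ (trans (toℚ-* (+ (j ∸ n)) (v2ℚ (c i))) (cong (ℚ._* height c i) (ι-∸ j n (ℕₚ.<⇒≤ n<j))))
                           (trans (toℚ-* (+ (n ∸ i)) (v2ℚ (c j))) (cong (ℚ._* height c j) (ι-∸ n i (ℕₚ.<⇒≤ i<n)))))

-- A point of the
-- epigraph of N(c) with x ≤ n lies above a chord between two points of c;
-- if that chord crosses x = n we shorten it at the vertex n (Segments.shorten),
-- and a chord entirely to the right of n cannot reach x ≤ n.
module VertexCut (c : ℕ → ℚ) (n : ℕ) (vertex : IsVertex c n) where
  keep : ℕ → Bool
  keep i = i ≤ᵇ n

  d : ℕ → ℚ
  d = trunc c keep

  d≡c : ∀ i → i ≤ n → d i ≡ c i
  d≡c i i≤n = trunc-kept c keep i (T-true (ℕₚ.≤⇒≤ᵇ i≤n))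
    where
    T-true : ∀ {b} → T b → b ≡ true
    T-true {true} _ = refl

  kept-chord : ∀ x y i j t → i ≤ n → j ≤ n → c i ≢ 0ℚ → c j ≢ 0ℚ → 0ℚ ℚ.≤ t → t ℚ.≤ 1ℚ →
    x ≡ lerp t (ι i) (ι j) → lerp t (height c i) (height c j) ℚ.≤ y → Epi d x y
  kept-chord x y i j t i≤n j≤n cᵢ≢0 cⱼ≢0 0≤t t≤1 x≡ above =
    i , j , t , (λ e → cᵢ≢0 (trans (sym (d≡c i i≤n)) e)) , (λ e → cⱼ≢0 (trans (sym (d≡c j j≤n)) e)) , 0≤t , t≤1 , x≡ ,
    subst₂ (λ u v → lerp t (toℚ (v2ℚ u)) (toℚ (v2ℚ v)) ℚ.≤ y) (sym (d≡c i i≤n)) (sym (d≡c j j≤n)) above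

  crossing-chord : ∀ x y i j t → x ℚ.≤ ι n → i ≤ n → n < j → c i ≢ 0ℚ → c j ≢ 0ℚ → 0ℚ ℚ.≤ t → t ℚ.≤ 1ℚ →
    x ≡ lerp t (ι i) (ι j) → lerp t (height c i) (height c j) ℚ.≤ y → Epi d x y
  crossing-chord x y i j t x≤n i≤n n<j cᵢ≢0 cⱼ≢0 0≤t t≤1 x≡ above with ℕₚ.<-≤-connex i n
  ... | inj₁ i<n =
    let (s , 0≤s , s≤1 , x≡′ , above′) = shorten (ι i) (ι n) (ι j) (height c i) (height c n) (height c j) x y t
                                           (ι-< i<n) (ι-< n<j) (BelowChord-ℚ c n i j (proj₂ vertex i j i<n n<j cᵢ≢0 cⱼ≢0) i<n n<j)
                                           0≤t x≡ above x≤n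
    in kept-chord x y i n s (ℕₚ.<⇒≤ i<n) ℕₚ.≤-refl cᵢ≢0 (proj₁ vertex) 0≤s s≤1 x≡′ above′
  ... | inj₂ n≤i = at-n i (ℕₚ.≤-antisym i≤n n≤i) cᵢ≢0 x≡ above
    where
    at-n : ∀ i → i ≡ n → c i ≢ 0ℚ → x ≡ lerp t (ι i) (ι j) → lerp t (height c i) (height c j) ℚ.≤ y → Epi d x y
    at-n .n refl cₙ≢0 x≡ above =
      let (x≡′ , above′) = at-start (ι n) (ι j) (height c n) (height c j) x y t (ι-< n<j) 0≤t x≡ x≤n above
      in kept-chord x y n n 0ℚ ℕₚ.≤-refl ℕₚ.≤-refl cₙ≢0 cₙ≢0 ℚₚ.≤-refl (ℚₚ.<⇒≤ (ℚₚ.positive⁻¹ 1ℚ)) x≡′ above′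

  to : ∀ x y → x ℚ.≤ ι n → Epi c x y → Epi d x y
  to x y x≤n (i , j , t , cᵢ≢0 , cⱼ≢0 , 0≤t , t≤1 , x≡ , above) with i ℕ.≤? n | j ℕ.≤? n
  ... | yes i≤n | yes j≤n = kept-chord x y i j t i≤n j≤n cᵢ≢0 cⱼ≢0 0≤t t≤1 x≡ above
  ... | yes i≤n | no j≰n  = crossing-chord x y i j t x≤n i≤n (ℕₚ.≰⇒> j≰n) cᵢ≢0 cⱼ≢0 0≤t t≤1 x≡ above
  ... | no i≰n  | yes j≤n = crossing-chord x y j i (1ℚ ℚ.- t) x≤n j≤n (ℕₚ.≰⇒> i≰n) cⱼ≢0 cᵢ≢0
                              (proj₁ (1-t∈[0,1] t 0≤t t≤1)) (proj₂ (1-t∈[0,1] t 0≤t t≤1))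
                              (trans x≡ (lerp-swap t (ι i) (ι j))) (subst (ℚ._≤ y) (lerp-swap t (height c i) (height c j)) above)
  ... | no i≰n  | no j≰n  = ⊥-elim (ℚₚ.<-irrefl refl (ℚₚ.<-≤-trans n<n+1 (ℚₚ.≤-trans (right-of (ι i) (ι n) (ι j) x t (beyond i≰n) (beyond j≰n) 0≤t t≤1 x≡) x≤n)))
    where
    beyond : ∀ {a} → ¬ (a ≤ n) → ι n ℚ.+ 1ℚ ℚ.≤ ι a
    beyond {a} a≰n = subst (ℚ._≤ ι a) (ι-suc n) (ι-≤ (ℕₚ.≰⇒> a≰n))
    n<n+1 : ι n ℚ.< ι n ℚ.+ 1ℚ
    n<n+1 = subst (ℚ._< ι n ℚ.+ 1ℚ) (ℚₚ.+-identityʳ (ι n)) (ℚₚ.+-monoʳ-< (ι n) (ℚₚ.positive⁻¹ 1ℚ))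

  from : ∀ x y → Epi d x y → Epi c x y
  from x y (i , j , t , dᵢ≢0 , dⱼ≢0 , 0≤t , t≤1 , x≡ , above) =
    i , j , t , (λ e → dᵢ≢0 (trans dᵢ≡cᵢ e)) , (λ e → dⱼ≢0 (trans dⱼ≡cⱼ e)) , 0≤t , t≤1 , x≡ ,
    subst₂ (λ u v → lerp t (toℚ (v2ℚ u)) (toℚ (v2ℚ v)) ℚ.≤ y) dᵢ≡cᵢ dⱼ≡cⱼ above
    where
    dᵢ≡cᵢ = trunc-kept c keep i (trunc-support c keep i dᵢ≢0)
    dⱼ≡cⱼ = trunc-kept c keep j (trunc-support c keep j dⱼ≢0)

vertex-cuts-polygon : ∀ c n → IsVertex c n → SamePolygonUpTo n c (trunc c (λ i → i ≤ᵇ n))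
vertex-cuts-polygon c n vertex x y _ x≤n = VertexCut.to c n vertex x y x≤n , VertexCut.from c n vertex x y

-- Lemma 5.5: the truncation at M is vertex-preserving at n, and a vertex at n
-- cuts the polygon.
lemma5p5 : (k n : ℕ) → 6 < k → 1 ≤ n →
    (IsVertex (PBC k) n ⇔ IsVertex (trunc (PBC k) (≤M k n)) n) ×
    (IsVertex (PBC k) n → SamePolygonUpTo n (PBC k) (trunc (PBC k) (λ i → i ≤ᵇ n)))
lemma5p5 k n _ 1≤n =
  vertex-truncation (PBC k) (≤M k n) n (≤M-prefix k n 1≤n) (≤M-dropped k n 1≤n) ,
  vertex-cuts-polygon (PBC k) n
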